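{- The two edge sets $A_1$ and $A_2$ defined by \[ A_1 = \{(p_2, x_1)\} \cup \{(y_i, x_{i+1}) \mid i = 1, \dots, k-1\} \cup \{(y_k, p_1)\},\qquad A_2 = \{(p_3, y_1)\} \cup \{(x_i, y_{i+1}) \mid i = 1, \ldots, k-1\} \cup \{(x_k, p_4)\} \] satisfy the following three conditions. (i) $S_i \cup A_i$ is a tour (Hamiltonian cycle) of $G$ for $i=1,2$. (ii) $V(A_i)=V_1(S_i)$ for $i=1,2$. (iii) $A_1 \cap A_2 = \emptyset$ and $A_1 \cup A_2$ consists of (iii-1) a $(p_1, p_4)$-path if $p_2 = p_3$; (iii-2) vertex-disjoint $(p_1, p_3)$- and $(p_2, p_4)$-paths if $p_2 \neq p_3$ and $k$ is odd; (iii-3) vertex-disjoint $(p_1, p_2)$- and $(p_3, p_4)$-paths if $p_2 \neq p_3$ and $k$ is even.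
   Context: Let $G=(V,E)$ be a complete graph with an even number of vertices and an edge length function $\ell:E\to\mathbb{R}_+$. For $F\subseteq E$, $V(F)$ is the set of vertices incident to edges of $F$, $V_1(F)$ is the set of vertices with exactly one incident edge in $F$, and for an acyclic 2-matching $F$ (a set of edges in which every vertex has at most two incident edges and there is no cycle), $\mathcal{P}(F)$ denotes the family of vertex-disjoint paths that $F$ forms. A path cover is a spanning acyclic 2-matching. Let $S$ be a 2-factor of $G$ containing at least two cycles, and let $C$ be one of its cycles. Let $e_1=(p_1,p_2)$ and $e_2=(p_3,p_4)$ be two edges of $C$ with $p_1\neq p_3,p_4$ and $p_4\neq p_1,p_2$ (possibly $p_2=p_3$). Let $S_1$ and $S_2$ be path covers of $G$ such that $\mathcal{P}(S_1)=\{Q_1,\dots,Q_k\}\cup\{P_1\}$ and $\mathcal{P}(S_2)=\{Q_1,\dots,Q_k\}\cup\{P_2\}$, where $P_1=C\setminus\{e_1\}$ is a $(p_1,p_2)$-path, $P_2=C\setminus\{e_2\}$ is a $(p_3,p_4)$-path, and $Q_1,\dots,Q_k$ ($k\ge 1$) are the vertex-disjoint paths common to $\mathcal{P}(S_1)$ and $\mathcal{P}(S_2)$ (these arise from the other cycles of $S$ by deleting one edge each), with $Q_i$ an $(x_i,y_i)$-path. The endpoints of $Q_1$ are labelled so that $\ell(p_2, x_1) + \ell(p_3, y_1) \leq \ell(p_2, y_1) + \ell(p_3, x_1)$.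
   Formalization: The edge length function ℓ takes nonnegative rational values instead of values in ℝ₊. -}

module Defs where

open import Level using (0ℓ)
open import Data.Nat using (ℕ; zero; suc; _≤_; _<_)
open import Data.Fin using (Fin)
open import Data.List using (List; []; _∷_; _++_; length)
open import Data.List.Membership.Propositional using (_∈_)
open import Data.List.Relation.Unary.Unique.Propositional using (Unique)
open import Data.Product using (Σ; ∃; ∃-syntax; _×_; _,_)
open import Data.Sum using (_⊎_)
open import Data.Empty using (⊥)
open import Relation.Nullary using (¬_)
open import Relation.Binary.PropositionalEquality using (_≡_; _≢_)
open import Function.Bundles using (_⇔_)

-- An (undirected) edge set of the complete graph on vertex set Fin n.
-- F u v means that the edge {u,v} belongs to F.  All edge sets built
-- below are symmetric; edge sets are compared extensionally (_≐_).
EdgeSet : ℕ → Set₁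
EdgeSet n = Fin n → Fin n → Set

module _ {n : ℕ} where

  V : Set
  V = Fin n

  E : V → V → EdgeSet n
  E a b u v = (u ≡ a × v ≡ b) ⊎ (u ≡ b × v ≡ a)

  _∪E_ : EdgeSet n → EdgeSet n → EdgeSet n
  (F ∪E H) u v = F u v ⊎ H u v

  _∩E_ : EdgeSet n → EdgeSet n → EdgeSet n
  (F ∩E H) u v = F u v × H u v

  _∖E_ : EdgeSet n → V × V → EdgeSet n
  (F ∖E (a , b)) u v = F u v × ¬ E a b u v

  _⊆E_ : EdgeSet n → EdgeSet n → Set
  F ⊆E H = ∀ u v → F u v → H u v

  _≐_ : EdgeSet n → EdgeSet n → Set
  F ≐ H = ∀ u v → F u v ⇔ H u v

  EmptyE : EdgeSet n → Set
  EmptyE F = ∀ u v → ¬ F u v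

  _∈V_ : V → EdgeSet n → Set
  v ∈V F = ∃[ a ] F v a

  _∈V₁_ : V → EdgeSet n → Set
  v ∈V₁ F = ∃[ a ] (F v a × (∀ b → F v b → b ≡ a))

  VDisjoint : EdgeSet n → EdgeSet n → Set
  VDisjoint F H = ∀ v → v ∈V F → ¬ (v ∈V H)

  IsEdgeSetOfGraph : EdgeSet n → Set
  IsEdgeSetOfGraph F = (∀ u v → F u v → F v u) × (∀ u → ¬ F u u)

  data Consec : List V → V → V → Set where
    here  : ∀ {a b xs} → Consec (a ∷ b ∷ xs) a b
    there : ∀ {c xs a b} → Consec xs a b → Consec (c ∷ xs) a b

  walkEdges : List V → EdgeSet n
  walkEdges vs u v = Consec vs u v ⊎ Consec vs v u

  IsPath : V → V → EdgeSet n → Set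
  IsPath u v P = ∃[ mid ] (Unique (u ∷ mid ++ v ∷ []) × (P ≐ walkEdges (u ∷ mid ++ v ∷ [])))

  IsSomePath : EdgeSet n → Set
  IsSomePath P = ∃[ u ] ∃[ v ] IsPath u v P

  cycleEdges : V → List V → EdgeSet n
  cycleEdges c rest = walkEdges (c ∷ rest ++ c ∷ [])

  IsCycleSeq : V → List V → Set
  IsCycleSeq c rest = Unique (c ∷ rest) × 2 ≤ length rest

  IsCycle : EdgeSet n → Set
  IsCycle C = ∃[ c ] ∃[ rest ] (IsCycleSeq c rest × C ≐ cycleEdges c rest)

  -- C is a cycle of the 2-factor S (for a 2-regular S, a cycle contained
  -- in S is exactly a connected component of S)
  _CycleOf_ : EdgeSet n → EdgeSet n → Set
  C CycleOf S = IsCycle C × C ⊆E S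

  IsTwoFactor : EdgeSet n → Set
  IsTwoFactor S = IsEdgeSetOfGraph S ×
    (∀ v → ∃[ a ] ∃[ b ] (a ≢ b × S v a × S v b × (∀ c → S v c → c ≡ a ⊎ c ≡ b)))

  IsAcyclicTwoMatching : EdgeSet n → Set
  IsAcyclicTwoMatching F = IsEdgeSetOfGraph F ×
    (∀ v a b c → F v a → F v b → F v c → a ≡ b ⊎ a ≡ c ⊎ b ≡ c) ×
    (∀ c rest → IsCycleSeq c rest → ¬ (cycleEdges c rest ⊆E F))

  IsPathCover : EdgeSet n → Set
  IsPathCover F = IsAcyclicTwoMatching F × (∀ v → v ∈V F)

  -- P ∈ 𝒫(F): P is a path of F which is a whole connected component of F
  _∈𝒫_ : EdgeSet n → EdgeSet n → Set
  P ∈𝒫 F = IsSomePath P × P ⊆E F × (∀ u w → u ∈V P → F u w → P u w)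

  IsTour : EdgeSet n → Set
  IsTour T = ∃[ c ] ∃[ rest ] (IsCycleSeq c rest × (∀ v → v ∈ (c ∷ rest)) × T ≐ cycleEdges c rest)

  -- the edge sets A₁ and A₂ (indices of Q_i run over 1..k)
  A₁ : (p₁ p₂ : V) (k : ℕ) (x y : ℕ → V) → EdgeSet n
  A₁ p₁ p₂ k x y u v =
    E p₂ (x 1) u v ⊎ (∃[ i ] (1 ≤ i × i < k × E (y i) (x (suc i)) u v)) ⊎ E (y k) p₁ u v

  A₂ : (p₃ p₄ : V) (k : ℕ) (x y : ℕ → V) → EdgeSet n
  A₂ p₃ p₄ k x y u v =
    E p₃ (y 1) u v ⊎ (∃[ i ] (1 ≤ i × i < k × E (x i) (y (suc i)) u v)) ⊎ E (x k) p₄ u v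

module Submission where

-- S₁ and S₂ are disjoint unions of the paths P₀, Q₁, …, Q_k, where P₀ is what remains of C, and these
-- are the only components (this is where acyclicity enters).  Joining the end of each path to the start
-- of the next one, cyclically, closes them into a Hamiltonian cycle; A₁ consists of exactly these joining
-- edges, and A₂ as well once every path is reversed, so the endpoints of A_i are the degree-one vertices
-- of S_i.  The edges of A₁ ∪ A₂ form the two alternating sequences p₂, x₁, y₂, x₃, … and p₃, y₁, x₂, y₃, …,
-- which are paths since C, Q₁, …, Q_k are pairwise vertex-disjoint; each ends in p₁ or p₄ according to the
-- parity of k, and when p₂ = p₃ they glue into one (p₁, p₄)-path.

open import Defs
open import Level using (0ℓ)
open import Data.Bool using (Bool; true; false; not)
open import Data.Empty using (⊥; ⊥-elim)
open import Data.Unit using (⊤; tt)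
open import Data.Nat using (ℕ; zero; suc; _+_; _≤_; _<_; z≤n; s≤s)
open import Data.Nat.Properties
  using (≮⇒≥; m≢1+n+m; m≤n+m; m≤m+n; m<m+n; ≤∧≢⇒<; +-suc; +-identityʳ; <⇒≱; ≤-refl; ≤-trans; <⇒≤;
         n≤1+n; m≤n⇒m≤1+n; m≤n⇒m<n∨m≡n; ≤-pred; 1+n≰n)
import Data.Nat.Properties as ℕₚ
open import Data.Nat.Divisibility using (_∣_; _∣?_; divides; ∣-refl; ∣1⇒≡1; ∣m∣n⇒∣m+n; ∣m+n∣m⇒∣n)
open import Data.Fin using (Fin)
import Data.Fin as Fin
open import Data.Fin.Properties using (pigeonhole)
open import Data.Rational as Rat using (ℚ; 0ℚ)
open import Data.Product using (Σ-syntax; ∃-syntax; _×_; _,_; proj₁; proj₂)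
open import Data.Sum using (_⊎_; inj₁; inj₂; swap)
open import Data.Sum.Function.Propositional using (_⊎-⇔_)
open import Data.List using (List; []; _∷_; _++_; _∷ʳ_; [_]; length; lookup; reverse; initLast; _∷ʳ′_)
open import Data.List.Properties using (++-assoc; unfold-reverse; reverse-++; reverse-involutive)
open import Data.List.Membership.Propositional using (_∈_; _∉_)
open import Data.List.Membership.Propositional.Properties using (∈-++⁺ˡ; ∈-++⁺ʳ; ∈-++⁻; ∈-lookup)
import Data.List.Membership.DecPropositional as DecMembership
open import Data.List.Relation.Unary.Any using (here; there)
open import Data.List.Relation.Unary.Any.Properties using (reverse⁻)
open import Data.List.Relation.Unary.All using ([])
open import Data.List.Relation.Unary.All.Properties using (¬Any⇒All¬)
open import Data.List.Relation.Unary.AllPairs using ([]; _∷_)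
open import Data.List.Relation.Unary.Unique.Propositional using (Unique)
open import Data.List.Relation.Unary.Unique.Propositional.Properties using (++⁺; Unique[x∷xs]⇒x∉xs)
open import Data.List.Relation.Binary.Disjoint.Propositional using (Disjoint)
open import Relation.Nullary using (¬_; yes; no; contradiction)
open import Relation.Nullary.Decidable using (decidable-stable; ¬¬-excluded-middle)
open import Relation.Binary.PropositionalEquality using (_≡_; _≢_; refl; sym; trans; subst; cong; module ≡-Reasoning)
import Relation.Binary.Reasoning.Setoid as SetoidReasoning
open import Function.Base using (_∘_)
open import Function.Bundles using (_⇔_; mk⇔; Equivalence)
import Function.Properties.Equivalence as ⇔

open Equivalence using (to; from)

module _ {A : Set} where

  private variable
    x : A
    xs ys : List A

  0<length-∷ʳ : ∀ xs → 0 < length (xs ∷ʳ x)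
  0<length-∷ʳ []      = s≤s z≤n
  0<length-∷ʳ (_ ∷ _) = s≤s z≤n

  Unique-∷ : x ∉ xs → Unique xs → Unique (x ∷ xs)
  Unique-∷ {xs = xs} x∉xs u = ¬Any⇒All¬ xs x∉xs ∷ u

  Unique-++⁻ˡ : ∀ xs → Unique (xs ++ ys) → Unique xs
  Unique-++⁻ˡ []       _           = []
  Unique-++⁻ˡ (x ∷ xs) u@(_ ∷ u′) =
    Unique-∷ (λ x∈xs → Unique[x∷xs]⇒x∉xs u (∈-++⁺ˡ x∈xs)) (Unique-++⁻ˡ xs u′)

  Unique-++⇒Disjoint : ∀ xs → Unique (xs ++ ys) → Disjoint xs ys
  Unique-++⇒Disjoint (_ ∷ xs) u       (here refl , v∈ys) = Unique[x∷xs]⇒x∉xs u (∈-++⁺ʳ xs v∈ys)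
  Unique-++⇒Disjoint (_ ∷ xs) (_ ∷ u) (there v∈xs , v∈ys) = Unique-++⇒Disjoint xs u (v∈xs , v∈ys)

  Unique-reverse : Unique xs → Unique (reverse xs)
  Unique-reverse {[]}     _           = []
  Unique-reverse {x ∷ xs} u@(_ ∷ u′) rewrite unfold-reverse x xs =
    ++⁺ (Unique-reverse u′) ([] ∷ []) λ { (x∈ , here refl) → Unique[x∷xs]⇒x∉xs u (reverse⁻ x∈) }

Unique-lookup-injective : ∀ {A : Set} {xs : List A} → Unique xs →
                          ∀ {i j} → i Fin.< j → lookup xs i ≢ lookup xs j
Unique-lookup-injective {xs = _ ∷ xs} u {Fin.zero} {Fin.suc j} _ eq =
  Unique[x∷xs]⇒x∉xs u (subst (_∈ xs) (sym eq) (∈-lookup j))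
Unique-lookup-injective (_ ∷ u) {Fin.suc i} {Fin.suc j} (s≤s i<j) =
  Unique-lookup-injective u i<j

Unique⇒length≤ : ∀ {n} {xs : List (Fin n)} → Unique xs → length xs ≤ n
Unique⇒length≤ {xs = xs} u = ≮⇒≥ λ n<len →
  let i , j , i<j , eq = pigeonhole n<len (lookup xs) in Unique-lookup-injective u i<j eq

-- Walks along vertex sequences

module _ {n : ℕ} where

  private variable
    a b c h u v w : Fin n
    xs ys mid : List (Fin n)
    P P′ P″ S : EdgeSet n

  Consec⇒∈ : Consec xs u v → u ∈ xs × v ∈ xs
  Consec⇒∈ here      = here refl , there (here refl)
  Consec⇒∈ (there c) = there (proj₁ (Consec⇒∈ c)) , there (proj₂ (Consec⇒∈ c))

  Consec⇒∈-tail : Consec (a ∷ xs) u v → v ∈ xs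
  Consec⇒∈-tail here      = here refl
  Consec⇒∈-tail (there c) = proj₂ (Consec⇒∈ c)

  Consec-here : u ≡ a → v ≡ b → Consec (a ∷ b ∷ xs) u v
  Consec-here refl refl = here

  ¬Consec-[_] : ∀ a → ¬ Consec [ a ] u v
  ¬Consec-[ _ ] (there ())

  Consec-++⁺ˡ : ∀ ys → Consec xs u v → Consec (xs ++ ys) u v
  Consec-++⁺ˡ _ here      = here
  Consec-++⁺ˡ _ (there c) = there (Consec-++⁺ˡ _ c)

  Consec-++⁺ʳ : ∀ xs → Consec ys u v → Consec (xs ++ ys) u v
  Consec-++⁺ʳ []       c = c
  Consec-++⁺ʳ (_ ∷ xs) c = there (Consec-++⁺ʳ xs c)

  Consec-++⁻ : ∀ xs → Consec (xs ++ b ∷ ys) u v → Consec (xs ∷ʳ b) u v ⊎ Consec (b ∷ ys) u v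
  Consec-++⁻ []           c         = inj₂ c
  Consec-++⁻ (_ ∷ [])     here      = inj₁ here
  Consec-++⁻ (_ ∷ [])     (there c) = inj₂ c
  Consec-++⁻ (_ ∷ _ ∷ xs) here      = inj₁ here
  Consec-++⁻ (_ ∷ x ∷ xs) (there c) with Consec-++⁻ (x ∷ xs) c
  ... | inj₁ c′ = inj₁ (there c′)
  ... | inj₂ c′ = inj₂ c′

  Consec-++⁺ : ∀ xs → Consec (xs ∷ʳ b) u v ⊎ Consec (b ∷ ys) u v → Consec (xs ++ b ∷ ys) u v
  Consec-++⁺ {b = b} {ys = ys} xs (inj₁ c) = subst (λ zs → Consec zs _ _) (++-assoc xs [ b ] ys) (Consec-++⁺ˡ ys c)
  Consec-++⁺ xs          (inj₂ c) = Consec-++⁺ʳ xs c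

  Consec-reverse : Consec xs u v → Consec (reverse xs) v u
  Consec-reverse {xs = a ∷ b ∷ ys} here rewrite unfold-reverse a (b ∷ ys) | unfold-reverse b ys =
    subst (λ zs → Consec zs b a) (sym (++-assoc (reverse ys) [ b ] [ a ])) (Consec-++⁺ʳ (reverse ys) here)
  Consec-reverse {xs = a ∷ xs} (there c) rewrite unfold-reverse a xs = Consec-++⁺ˡ [ a ] (Consec-reverse c)

  walkEdges-sym : walkEdges xs u v → walkEdges xs v u
  walkEdges-sym (inj₁ c) = inj₂ c
  walkEdges-sym (inj₂ c) = inj₁ c

  walkEdges⇒∈ : walkEdges xs u v → u ∈ xs
  walkEdges⇒∈ (inj₁ c) = proj₁ (Consec⇒∈ c)
  walkEdges⇒∈ (inj₂ c) = proj₂ (Consec⇒∈ c)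

  walkEdges-∷ : walkEdges xs u v → walkEdges (a ∷ xs) u v
  walkEdges-∷ (inj₁ c) = inj₁ (there c)
  walkEdges-∷ (inj₂ c) = inj₂ (there c)

  walkEdges-reverse⁺ : walkEdges xs u v → walkEdges (reverse xs) u v
  walkEdges-reverse⁺ (inj₁ c) = inj₂ (Consec-reverse c)
  walkEdges-reverse⁺ (inj₂ c) = inj₁ (Consec-reverse c)

  walkEdges-reverse⁻ : walkEdges (reverse xs) u v → walkEdges xs u v
  walkEdges-reverse⁻ {xs = xs} e =
    subst (λ zs → walkEdges zs _ _) (reverse-involutive xs) (walkEdges-reverse⁺ e)

  pathSeq : Fin n → List (Fin n) → Fin n → List (Fin n)
  pathSeq h mid a = h ∷ mid ++ [ a ]

  headNeighbour : List (Fin n) → Fin n → Fin n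
  headNeighbour []      a = a
  headNeighbour (s ∷ _) a = s

  lastNeighbour : Fin n → List (Fin n) → Fin n
  lastNeighbour h mid = headNeighbour (reverse mid) h

  headNeighbour-∈ : ∀ xs → headNeighbour xs a ∈ xs ∷ʳ a
  headNeighbour-∈ []      = here refl
  headNeighbour-∈ (_ ∷ _) = here refl

  lastNeighbour-∈ : ∀ s ms → lastNeighbour h (s ∷ ms) ∈ s ∷ ms
  lastNeighbour-∈ {h = h} s ms =
    reverse⁻ (subst (λ zs → headNeighbour zs h ∈ zs) (sym (unfold-reverse s ms)) (go (reverse ms)))
    where
    go : ∀ xs → headNeighbour (xs ∷ʳ s) h ∈ xs ∷ʳ s
    go []      = here refl
    go (_ ∷ _) = here refl

  pathSeq-∈ : v ∈ pathSeq h mid a → v ≡ h ⊎ v ≡ a ⊎ v ∈ mid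
  pathSeq-∈ (here refl) = inj₁ refl
  pathSeq-∈ {mid = mid} (there v∈) with ∈-++⁻ mid v∈
  ... | inj₁ v∈mid        = inj₂ (inj₂ v∈mid)
  ... | inj₂ (here refl) = inj₂ (inj₁ refl)

  inner≢head : Unique (pathSeq h mid a) → v ∈ mid → v ≢ h
  inner≢head u v∈ refl = Unique[x∷xs]⇒x∉xs u (∈-++⁺ˡ v∈)

  inner≢last : Unique (pathSeq h mid a) → v ∈ mid → v ≢ a
  inner≢last {h = h} {mid = mid} u v∈ refl =
    Unique-++⇒Disjoint (h ∷ mid) u (there v∈ , here refl)

  pathSeq-reverse : ∀ h mid a → reverse (pathSeq h mid a) ≡ pathSeq a (reverse mid) h
  pathSeq-reverse h mid a = begin
    reverse (h ∷ mid ++ [ a ])   ≡⟨ unfold-reverse h (mid ++ [ a ]) ⟩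
    reverse (mid ++ [ a ]) ∷ʳ h  ≡⟨ cong (_∷ʳ h) (reverse-++ mid [ a ]) ⟩
    pathSeq a (reverse mid) h    ∎
    where open ≡-Reasoning

  Unique-pathSeq-reverse : Unique (pathSeq h mid a) → Unique (pathSeq a (reverse mid) h)
  Unique-pathSeq-reverse {h} {mid} {a} u = subst Unique (pathSeq-reverse h mid a) (Unique-reverse u)

  pathSeq-reverse⁺ : walkEdges (pathSeq h mid a) u v → walkEdges (pathSeq a (reverse mid) h) u v
  pathSeq-reverse⁺ {h} {mid} {a} e =
    subst (λ zs → walkEdges zs _ _) (pathSeq-reverse h mid a) (walkEdges-reverse⁺ e)

  pathSeq-reverse⁻ : walkEdges (pathSeq a (reverse mid) h) u v → walkEdges (pathSeq h mid a) u v
  pathSeq-reverse⁻ {a} {mid} {h} e =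
    walkEdges-reverse⁻ (subst (λ zs → walkEdges zs _ _) (sym (pathSeq-reverse h mid a)) e)

  pathSeq-head-edge : ∀ h mid a → Consec (pathSeq h mid a) h (headNeighbour mid a)
  pathSeq-head-edge _ []      _ = here
  pathSeq-head-edge _ (_ ∷ _) _ = here

  pathSeq-head-edge-unique : Unique (pathSeq h mid a) → walkEdges (pathSeq h mid a) h c →
                             c ≡ headNeighbour mid a
  pathSeq-head-edge-unique {mid = []}    _ (inj₁ here)      = refl
  pathSeq-head-edge-unique {mid = _ ∷ _} _ (inj₁ here)      = refl
  pathSeq-head-edge-unique               u (inj₁ (there c)) = ⊥-elim (Unique[x∷xs]⇒x∉xs u (proj₁ (Consec⇒∈ c)))
  pathSeq-head-edge-unique               u (inj₂ c)         = ⊥-elim (Unique[x∷xs]⇒x∉xs u (Consec⇒∈-tail c))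

  pathSeq-last-edge : ∀ h mid a → walkEdges (pathSeq h mid a) a (lastNeighbour h mid)
  pathSeq-last-edge h mid a = pathSeq-reverse⁻ (inj₁ (pathSeq-head-edge a (reverse mid) h))

  pathSeq-inner-edges : Unique (pathSeq h mid a) → v ∈ mid →
    ∃[ p ] ∃[ q ] (p ≢ q × walkEdges (pathSeq h mid a) v p × walkEdges (pathSeq h mid a) v q)
  pathSeq-inner-edges {h} {m ∷ ms} {a} u (here refl) =
    h , headNeighbour ms a , h≢next , inj₂ here , inj₁ (there (pathSeq-head-edge m ms a))
    where
    h≢next : h ≢ headNeighbour ms a
    h≢next eq = Unique[x∷xs]⇒x∉xs u (there (subst (_∈ ms ++ [ a ]) (sym eq) (headNeighbour-∈ ms)))
  pathSeq-inner-edges {mid = _ ∷ _} (_ ∷ u) (there v∈) =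
    let p , q , p≢q , e₁ , e₂ = pathSeq-inner-edges u v∈ in p , q , p≢q , walkEdges-∷ e₁ , walkEdges-∷ e₂

  pathSeq-edge : Unique (pathSeq h mid a) → v ∈ pathSeq h mid a → ∃[ c ] walkEdges (pathSeq h mid a) v c
  pathSeq-edge {h} {mid} {a} u v∈ with pathSeq-∈ v∈
  ... | inj₁ refl          = _ , inj₁ (pathSeq-head-edge h mid a)
  ... | inj₂ (inj₁ refl)   = _ , pathSeq-last-edge h mid a
  ... | inj₂ (inj₂ v∈mid) = let p , _ , _ , e , _ = pathSeq-inner-edges u v∈mid in p , e

  ≐-refl : P ≐ P
  ≐-refl _ _ = ⇔.refl

  ≐-sym : P ≐ P′ → P′ ≐ P
  ≐-sym eq u v = ⇔.sym (eq u v)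

  ≐-trans : P ≐ P′ → P′ ≐ P″ → P ≐ P″
  ≐-trans eq eq′ u v = ⇔.trans (eq u v) (eq′ u v)

  ∪E-congˡ : P ≐ P′ → (S ∪E P) ≐ (S ∪E P′)
  ∪E-congˡ eq u v = ⇔.refl ⊎-⇔ eq u v

  ∈V-resp : P ≐ P′ → v ∈V P → v ∈V P′
  ∈V-resp eq (w , p) = w , to (eq _ w) p

  IsTour-resp : P ≐ P′ → IsTour P → IsTour P′
  IsTour-resp P≐P′ (c , rest , cycle , spans , eq) = c , rest , cycle , spans , ≐-trans (≐-sym P≐P′) eq

  ∪E-comm : (P ∪E P′) ≐ (P′ ∪E P)
  ∪E-comm _ _ = mk⇔ swap swap

  ∈pathSeq⇒∈V : Unique (pathSeq h mid a) → P ≐ walkEdges (pathSeq h mid a) → v ∈ pathSeq h mid a → v ∈V P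
  ∈pathSeq⇒∈V u eq v∈ = let c , e = pathSeq-edge u v∈ in c , from (eq _ c) e

  ∈V⇒∈ : P ≐ walkEdges xs → v ∈V P → v ∈ xs
  ∈V⇒∈ eq (c , p) = walkEdges⇒∈ (to (eq _ c) p)

  IsPath-head∈V : IsPath a b P → a ∈V P
  IsPath-head∈V (_ , u , eq) = ∈pathSeq⇒∈V u eq (here refl)

  IsPath-last∈V : IsPath a b P → b ∈V P
  IsPath-last∈V (mid , u , eq) = ∈pathSeq⇒∈V u eq (there (∈-++⁺ʳ mid (here refl)))

  IsPath-end∈V : IsPath a b P → v ≡ a ⊎ v ≡ b → v ∈V P
  IsPath-end∈V path (inj₁ refl) = IsPath-head∈V path
  IsPath-end∈V path (inj₂ refl) = IsPath-last∈V path

  IsPath⇒≢ : IsPath a b P → a ≢ b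
  IsPath⇒≢ (mid , u , _) refl = Unique[x∷xs]⇒x∉xs u (∈-++⁺ʳ mid (here refl))

  IsPath-sym : IsPath a b P → P u v → P v u
  IsPath-sym (_ , _ , eq) p = from (eq _ _) (walkEdges-sym (to (eq _ _) p))

  IsPath-reverse : IsPath a b P → IsPath b a P
  IsPath-reverse (mid , u , eq) =
    reverse mid , Unique-pathSeq-reverse u ,
    λ x y → mk⇔ (pathSeq-reverse⁺ ∘ to (eq x y)) (from (eq x y) ∘ pathSeq-reverse⁻)

  IsPath-resp : P ≐ P′ → IsPath a b P → IsPath a b P′
  IsPath-resp P≐P′ (mid , u , eq) = mid , u , ≐-trans (≐-sym P≐P′) eq

  IsPath-edge : a ≢ b → IsPath a b (E a b)
  IsPath-edge {a} {b} a≢b = [] , Unique-∷ (λ { (here a≡b) → a≢b a≡b }) ([] ∷ []) , λ _ _ → mk⇔ to′ from′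
    where
    to′ : E a b u v → walkEdges (a ∷ [ b ]) u v
    to′ (inj₁ (refl , refl)) = inj₁ here
    to′ (inj₂ (refl , refl)) = inj₂ here
    from′ : walkEdges (a ∷ [ b ]) u v → E a b u v
    from′ (inj₁ here)      = inj₁ (refl , refl)
    from′ (inj₁ (there k)) = ⊥-elim (¬Consec-[ b ] k)
    from′ (inj₂ here)      = inj₂ (refl , refl)
    from′ (inj₂ (there k)) = ⊥-elim (¬Consec-[ b ] k)

  ∈V-E : v ∈V E a b → v ≡ a ⊎ v ≡ b
  ∈V-E (_ , inj₁ (v≡a , _)) = inj₁ v≡a
  ∈V-E (_ , inj₂ (v≡b , _)) = inj₂ v≡b

  IsPath-∪ : IsPath a b P → IsPath b c P′ → (∀ v → v ∈V P → v ∈V P′ → v ≡ b) → IsPath a c (P ∪E P′)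
  IsPath-∪ {a} {b} {P} {c} {P′} (m , uP , eqP) (m′ , uP′ , eqP′) shared = m ++ b ∷ m′ , unique , edges
    where
    assoc : pathSeq a (m ++ b ∷ m′) c ≡ (a ∷ m) ++ pathSeq b m′ c
    assoc = cong (a ∷_) (++-assoc m (b ∷ m′) [ c ])
    disjoint : Disjoint (a ∷ m) (pathSeq b m′ c)
    disjoint {v} (v∈ , v∈′) with shared v (∈pathSeq⇒∈V uP eqP (∈-++⁺ˡ v∈)) (∈pathSeq⇒∈V uP′ eqP′ v∈′)
    ... | refl = Unique-++⇒Disjoint (a ∷ m) uP (v∈ , here refl)
    unique : Unique (pathSeq a (m ++ b ∷ m′) c)
    unique = subst Unique (sym assoc) (++⁺ (Unique-++⁻ˡ (a ∷ m) uP) uP′ disjoint)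
    split : Consec (pathSeq a (m ++ b ∷ m′) c) u v → Consec (pathSeq a m b) u v ⊎ Consec (pathSeq b m′ c) u v
    split {u} {v} k = Consec-++⁻ (a ∷ m) (subst (λ zs → Consec zs u v) assoc k)
    join : Consec (pathSeq a m b) u v ⊎ Consec (pathSeq b m′ c) u v → Consec (pathSeq a (m ++ b ∷ m′) c) u v
    join {u} {v} k = subst (λ zs → Consec zs u v) (sym assoc) (Consec-++⁺ (a ∷ m) k)
    edges : (P ∪E P′) ≐ walkEdges (pathSeq a (m ++ b ∷ m′) c)
    edges u v = mk⇔ to′ from′
      where
      to′ : (P ∪E P′) u v → walkEdges (pathSeq a (m ++ b ∷ m′) c) u v
      to′ (inj₁ p) with to (eqP u v) p
      ... | inj₁ k = inj₁ (join (inj₁ k))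
      ... | inj₂ k = inj₂ (join (inj₁ k))
      to′ (inj₂ p) with to (eqP′ u v) p
      ... | inj₁ k = inj₁ (join (inj₂ k))
      ... | inj₂ k = inj₂ (join (inj₂ k))
      from′ : walkEdges (pathSeq a (m ++ b ∷ m′) c) u v → (P ∪E P′) u v
      from′ (inj₁ k) with split k
      ... | inj₁ k′ = inj₁ (from (eqP u v) (inj₁ k′))
      ... | inj₂ k′ = inj₂ (from (eqP′ u v) (inj₁ k′))
      from′ (inj₂ k) with split k
      ... | inj₁ k′ = inj₁ (from (eqP u v) (inj₂ k′))
      ... | inj₂ k′ = inj₂ (from (eqP′ u v) (inj₂ k′))

  IsPath-head-V₁ : IsPath a b P → a ∈V₁ P
  IsPath-head-V₁ {a} {b} (mid , u , eq) =
    headNeighbour mid b , from (eq _ _) (inj₁ (pathSeq-head-edge a mid b)) ,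
    λ _ p → pathSeq-head-edge-unique u (to (eq _ _) p)

  IsPath-last-V₁ : IsPath a b P → b ∈V₁ P
  IsPath-last-V₁ = IsPath-head-V₁ ∘ IsPath-reverse

  IsPath-V₁⇒end : IsPath a b P → v ∈V₁ P → v ≡ a ⊎ v ≡ b
  IsPath-V₁⇒end (mid , u , eq) (c , pvc , only) with pathSeq-∈ (∈V⇒∈ eq (c , pvc))
  ... | inj₁ v≡a         = inj₁ v≡a
  ... | inj₂ (inj₁ v≡b)  = inj₂ v≡b
  ... | inj₂ (inj₂ v∈) =
    let p , q , p≢q , e₁ , e₂ = pathSeq-inner-edges u v∈
    in ⊥-elim (p≢q (trans (only p (from (eq _ _) e₁)) (sym (only q (from (eq _ _) e₂)))))

  private
    closing-assoc : ∀ c mid l → pathSeq c mid l ∷ʳ c ≡ (c ∷ mid) ++ l ∷ [ c ]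
    closing-assoc c mid l = cong (c ∷_) (++-assoc mid [ l ] [ c ])

  Consec-closed⁻ : ∀ c mid l → Consec (pathSeq c mid l ∷ʳ c) u v → Consec (pathSeq c mid l) u v ⊎ (u ≡ l × v ≡ c)
  Consec-closed⁻ {u = u} {v = v} c mid l k
    with Consec-++⁻ (c ∷ mid) (subst (λ zs → Consec zs u v) (closing-assoc c mid l) k)
  ... | inj₁ k′         = inj₁ k′
  ... | inj₂ here       = inj₂ (refl , refl)
  ... | inj₂ (there k′) = ⊥-elim (¬Consec-[ c ] k′)

  Consec-closed⁺ : ∀ c mid l → Consec (pathSeq c mid l) u v ⊎ (u ≡ l × v ≡ c) → Consec (pathSeq c mid l ∷ʳ c) u v
  Consec-closed⁺ c mid l (inj₁ k)            = Consec-++⁺ˡ [ c ] k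
  Consec-closed⁺ c mid l (inj₂ (refl , refl)) =
    subst (λ zs → Consec zs l c) (sym (closing-assoc c mid l)) (Consec-++⁺ (c ∷ mid) (inj₂ here))

  cycleEdges-pathSeq : ∀ c mid l → cycleEdges c (mid ∷ʳ l) ≐ (walkEdges (pathSeq c mid l) ∪E E l c)
  cycleEdges-pathSeq c mid l u v = mk⇔ to′ from′
    where
    to′ : cycleEdges c (mid ∷ʳ l) u v → (walkEdges (pathSeq c mid l) ∪E E l c) u v
    to′ (inj₁ k) with Consec-closed⁻ c mid l k
    ... | inj₁ k′ = inj₁ (inj₁ k′)
    ... | inj₂ e  = inj₂ (inj₁ e)
    to′ (inj₂ k) with Consec-closed⁻ c mid l k
    ... | inj₁ k′        = inj₁ (inj₂ k′)
    ... | inj₂ (e₁ , e₂) = inj₂ (inj₂ (e₂ , e₁))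
    from′ : (walkEdges (pathSeq c mid l) ∪E E l c) u v → cycleEdges c (mid ∷ʳ l) u v
    from′ (inj₁ (inj₁ k))         = inj₁ (Consec-closed⁺ c mid l (inj₁ k))
    from′ (inj₁ (inj₂ k))         = inj₂ (Consec-closed⁺ c mid l (inj₁ k))
    from′ (inj₂ (inj₁ e))         = inj₁ (Consec-closed⁺ c mid l (inj₂ e))
    from′ (inj₂ (inj₂ (e₁ , e₂))) = inj₂ (Consec-closed⁺ c mid l (inj₂ (e₂ , e₁)))

  IsCycle-sym : IsCycle P → P u v → P v u
  IsCycle-sym (_ , _ , _ , eq) p = from (eq _ _) (walkEdges-sym (to (eq _ _) p))

  IsCycle-two-neighbours : IsCycle P → u ∈V P → ∃[ p ] ∃[ q ] (p ≢ q × P u p × P u q)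
  IsCycle-two-neighbours {P = P} {u = u} (c , rest , (uniq , len) , eq) (w , puw) with initLast rest
  ... | []             = contradiction len λ ()
  ... | [] ∷ʳ′ _       = contradiction len λ { (s≤s ()) }
  ... | (s ∷ ms) ∷ʳ′ l = neighbours (pathSeq-∈ u∈)
    where
    seq-edge : walkEdges (pathSeq c (s ∷ ms) l) ⊆E P
    seq-edge x y e = from (eq x y) (from (cycleEdges-pathSeq c (s ∷ ms) l x y) (inj₁ e))
    closing-edge : E l c ⊆E P
    closing-edge x y e = from (eq x y) (from (cycleEdges-pathSeq c (s ∷ ms) l x y) (inj₂ e))
    u∈ : u ∈ pathSeq c (s ∷ ms) l
    u∈ with to (cycleEdges-pathSeq c (s ∷ ms) l u w) (to (eq u w) puw)
    ... | inj₁ e                 = walkEdges⇒∈ e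
    ... | inj₂ (inj₁ (refl , _)) = there (∈-++⁺ʳ (s ∷ ms) (here refl))
    ... | inj₂ (inj₂ (refl , _)) = here refl
    neighbours : u ≡ c ⊎ u ≡ l ⊎ u ∈ s ∷ ms → ∃[ p ] ∃[ q ] (p ≢ q × P u p × P u q)
    neighbours (inj₁ refl) =
      s , l , inner≢last uniq (here refl) ,
      seq-edge _ _ (inj₁ (pathSeq-head-edge c (s ∷ ms) l)) , closing-edge _ _ (inj₂ (refl , refl))
    neighbours (inj₂ (inj₁ refl)) =
      lastNeighbour c (s ∷ ms) , c , inner≢head uniq (lastNeighbour-∈ s ms) ,
      seq-edge _ _ (pathSeq-last-edge c (s ∷ ms) l) , closing-edge _ _ (inj₁ (refl , refl))
    neighbours (inj₂ (inj₂ u∈mid)) =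
      let p , q , p≢q , e₁ , e₂ = pathSeq-inner-edges uniq u∈mid
      in p , q , p≢q , seq-edge _ _ e₁ , seq-edge _ _ e₂

  TwoFactor-cycle-closed : IsTwoFactor S → P CycleOf S → u ∈V P → S u w → P u w
  TwoFactor-cycle-closed {u = u} {w = w} (_ , two) (cycle , P⊆S) u∈ suw
    with IsCycle-two-neighbours cycle u∈ | two u
  ... | p , q , p≢q , pup , puq | _ , _ , _ , _ , _ , only
    with only p (P⊆S _ _ pup) | only q (P⊆S _ _ puq) | only w suw
  ... | inj₁ refl | inj₁ refl | _         = ⊥-elim (p≢q refl)
  ... | inj₂ refl | inj₂ refl | _         = ⊥-elim (p≢q refl)
  ... | inj₁ refl | inj₂ refl | inj₁ refl = pup
  ... | inj₁ refl | inj₂ refl | inj₂ refl = puq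
  ... | inj₂ refl | inj₁ refl | inj₁ refl = puq
  ... | inj₂ refl | inj₁ refl | inj₂ refl = pup

  Consec-propagate : (Q : Fin n → Set) →
                     (∀ {a b} → Consec xs a b → Q a → Q b) → (∀ {a b} → Consec xs a b → Q b → Q a) →
                     u ∈ xs → Q u → v ∈ xs → Q v
  Consec-propagate {xs = _ ∷ []}    _ _   _   (here refl) qu (here refl) = qu
  Consec-propagate {xs = _ ∷ _ ∷ _} _ _   _   (here refl) qu (here refl) = qu
  Consec-propagate {xs = _ ∷ _ ∷ _} Q fwd bwd (here refl) qu (there v∈) =
    Consec-propagate Q (fwd ∘ there) (bwd ∘ there) (here refl) (fwd here qu) v∈
  Consec-propagate {xs = _ ∷ _ ∷ _} Q fwd bwd (there u∈) qu (there v∈) =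
    Consec-propagate Q (fwd ∘ there) (bwd ∘ there) u∈ qu v∈
  Consec-propagate {xs = _ ∷ _ ∷ _} Q fwd bwd (there u∈) qu (here refl) =
    bwd here (Consec-propagate Q (fwd ∘ there) (bwd ∘ there) u∈ qu (here refl))

  CycleOf-overlap⇒⊆ : IsTwoFactor S → P CycleOf S → P′ CycleOf S → u ∈V P → u ∈V P′ → P ⊆E P′
  CycleOf-overlap⇒⊆ {S = S} {P′ = P′} two (cycle@(c , rest , _ , eq) , P⊆S) C′@(cycle′ , _) u∈P u∈P′ x y pxy =
    TwoFactor-cycle-closed two C′ (on-P′ (∈V⇒∈ eq (y , pxy))) (P⊆S x y pxy)
    where
    step : S a b → a ∈V P′ → b ∈V P′
    step {a} sab a∈ = a , IsCycle-sym cycle′ (TwoFactor-cycle-closed two C′ a∈ sab)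
    on-P′ : v ∈ c ∷ rest ++ [ c ] → v ∈V P′
    on-P′ = Consec-propagate (_∈V P′)
      (λ k → step (P⊆S _ _ (from (eq _ _) (inj₁ k))))
      (λ k → step (P⊆S _ _ (IsCycle-sym cycle (from (eq _ _) (inj₁ k)))))
      (∈V⇒∈ eq u∈P) u∈P′

cycle-remainder-disjoint : ∀ {n} {S C R : EdgeSet n} {v} → IsTwoFactor S → C CycleOf S →
  ∃[ D ] (D CycleOf S × ¬ (D ≐ C) × ∃[ a ] ∃[ b ] (D a b × R ≐ (D ∖E (a , b)))) →
  v ∈V C → ¬ v ∈V R
cycle-remainder-disjoint two C-cycle (D , D-cycle , D≉C , _ , _ , _ , R≐) v∈C (w , r) =
  D≉C λ a b → mk⇔ (CycleOf-overlap⇒⊆ two D-cycle C-cycle v∈D v∈C a b)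
                  (CycleOf-overlap⇒⊆ two C-cycle D-cycle v∈C v∈D a b)
  where
  v∈D = w , proj₁ (to (R≐ _ w) r)

disjoint-paths-end-index : ∀ {n k} {x y : ℕ → Fin n} {Q : ℕ → EdgeSet n} →
  (∀ i → 1 ≤ i → i ≤ k → IsPath (x i) (y i) (Q i)) →
  (∀ i j → 1 ≤ i → i ≤ k → 1 ≤ j → j ≤ k → i ≢ j → VDisjoint (Q i) (Q j)) →
  ∀ {i j v} → 1 ≤ i → i ≤ k → 1 ≤ j → j ≤ k → v ≡ x i ⊎ v ≡ y i → v ≡ x j ⊎ v ≡ y j → i ≡ j
disjoint-paths-end-index Q-path Q-disjoint {i} {j} 1≤i i≤k 1≤j j≤k end-i end-j with i ℕₚ.≟ j
... | yes i≡j = i≡j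
... | no  i≢j = ⊥-elim (Q-disjoint i j 1≤i i≤k 1≤j j≤k i≢j _
                          (IsPath-end∈V (Q-path i 1≤i i≤k) end-i) (IsPath-end∈V (Q-path j 1≤j j≤k) end-j))

-- Components of an acyclic 2-matching

module _ {n : ℕ} {F : EdgeSet n} (acyclic : IsAcyclicTwoMatching F) where

  private variable
    a b h u v w z : Fin n
    mid : List (Fin n)

  private
    F-sym : F u v → F v u
    F-sym = proj₁ (proj₁ acyclic) _ _

    F-irrefl : ¬ F u u
    F-irrefl = proj₂ (proj₁ acyclic) _

    F-degree : F v a → F v b → F v w → a ≡ b ⊎ a ≡ w ⊎ b ≡ w
    F-degree = proj₁ (proj₂ acyclic) _ _ _ _

    F-acyclic : ∀ c rest → IsCycleSeq c rest → ¬ (cycleEdges c rest ⊆E F)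
    F-acyclic = proj₂ (proj₂ acyclic)

  pathSeq-inner-closed : Unique (pathSeq h mid a) → walkEdges (pathSeq h mid a) ⊆E F →
                         v ∈ mid → F v w → walkEdges (pathSeq h mid a) v w
  pathSeq-inner-closed u ⊆F v∈ fvw with pathSeq-inner-edges u v∈
  ... | p , q , p≢q , e₁ , e₂ with F-degree (⊆F _ _ e₁) (⊆F _ _ e₂) fvw
  ...   | inj₁ p≡q        = ⊥-elim (p≢q p≡q)
  ...   | inj₂ (inj₁ refl) = e₁
  ...   | inj₂ (inj₂ refl) = e₂

  IsLeaf : Fin n → Set
  IsLeaf v = ∀ {b c} → F v b → F v c → b ≡ c

  leaf-path-component : Unique (pathSeq h mid a) → walkEdges (pathSeq h mid a) ⊆E F →
                        IsLeaf h → IsLeaf a → walkEdges (pathSeq h mid a) ∈𝒫 F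
  leaf-path-component {h} {mid} {a} u ⊆F leaf-h leaf-a = (h , a , mid , u , ≐-refl) , ⊆F , closed
    where
    closed : ∀ x y → x ∈V walkEdges (pathSeq h mid a) → F x y → walkEdges (pathSeq h mid a) x y
    closed x y (z , e) fxy with pathSeq-∈ (walkEdges⇒∈ e)
    ... | inj₁ refl          = subst (walkEdges _ x) (leaf-h (⊆F _ _ e) fxy) e
    ... | inj₂ (inj₁ refl)   = subst (walkEdges _ x) (leaf-a (⊆F _ _ e) fxy) e
    ... | inj₂ (inj₂ x∈mid) = pathSeq-inner-closed u ⊆F x∈mid fxy

  record Walk (a : Fin n) : Set where
    constructor walk
    field
      head   : Fin n
      inner  : List (Fin n)
      unique : Unique (pathSeq head inner a)
      ⊆F     : walkEdges (pathSeq head inner a) ⊆E F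

  open Walk

  Stuck : Walk a → Set
  Stuck {a} w = ∀ z → F (head w) z → z ∈ pathSeq (head w) (inner w) a

  Walk-edge : F b a → Walk a
  Walk-edge {b} {a} fba = walk b [] (Unique-∷ (λ { (here refl) → F-irrefl fba }) ([] ∷ [])) ⊆F′
    where
    ⊆F′ : walkEdges (b ∷ [ a ]) ⊆E F
    ⊆F′ _ _ (inj₁ here)      = fba
    ⊆F′ _ _ (inj₂ here)      = F-sym fba
    ⊆F′ _ _ (inj₁ (there k)) = ⊥-elim (¬Consec-[ a ] k)
    ⊆F′ _ _ (inj₂ (there k)) = ⊥-elim (¬Consec-[ a ] k)

  Walk-extend : (w : Walk a) → F (head w) z → z ∉ pathSeq (head w) (inner w) a → Walk a
  Walk-extend {z = z} (walk h mid u ⊆F) fhz z∉ = walk z (h ∷ mid) (Unique-∷ z∉ u) ⊆F′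
    where
    ⊆F′ : walkEdges (z ∷ pathSeq h mid _) ⊆E F
    ⊆F′ _ _ (inj₁ here)      = F-sym fhz
    ⊆F′ _ _ (inj₂ here)      = fhz
    ⊆F′ _ _ (inj₁ (there k)) = ⊆F _ _ (inj₁ k)
    ⊆F′ _ _ (inj₂ (there k)) = ⊆F _ _ (inj₂ k)

  open DecMembership (Fin._≟_ {n}) using (_∈?_)

  -- The walk cannot outgrow n vertices.  Whether the head has a neighbour off the walk is not
  -- decidable, hence the double negation.
  stuck-walk : (Inv : Fin n → Set) → (∀ {h z} → Inv h → F h z → Inv z) →
               (w : Walk a) → Inv (head w) → ¬ ¬ (Σ[ w′ ∈ Walk a ] (Stuck w′ × Inv (head w′)))
  stuck-walk {a} Inv step w₀ inv₀ = go (suc n) w₀ inv₀ (m≤n+m (suc n) (length (pathSeq (head w₀) (inner w₀) a)))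
    where
    go : ∀ fuel (w : Walk a) → Inv (head w) → n < length (pathSeq (head w) (inner w) a) + fuel →
         ¬ ¬ (Σ[ w′ ∈ Walk a ] (Stuck w′ × Inv (head w′)))
    go zero w _ n<len _ =
      <⇒≱ (subst (n <_) (+-identityʳ _) n<len) (Unique⇒length≤ (unique w))
    go (suc fuel) w inv n<len no-stuck = ¬¬-excluded-middle {A = Extensible} λ
      { (yes (z , fhz , z∉)) → go fuel (Walk-extend w fhz z∉) (step inv fhz) (subst (n <_) (+-suc _ fuel) n<len) no-stuck
      ; (no cannot-extend) → no-stuck (w , stuck cannot-extend , inv) }
      where
      Extensible = ∃[ z ] (F (head w) z × z ∉ pathSeq (head w) (inner w) a)
      stuck : ¬ Extensible → Stuck w
      stuck cannot-extend z fhz = decidable-stable (z ∈? _) λ z∉ → cannot-extend (z , fhz , z∉)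

  -- An edge from the head back to the far end would close a cycle; one into the interior would give
  -- an interior vertex a third neighbour.
  stuck-neighbour : (w : Walk a) → Stuck w → F (head w) z → z ≡ headNeighbour (inner w) a
  stuck-neighbour {z = z} (walk h mid u ⊆F) stuck fhz with pathSeq-∈ (stuck z fhz)
  ... | inj₁ refl = ⊥-elim (F-irrefl fhz)
  stuck-neighbour (walk h [] _ _) _ _ | inj₂ (inj₁ refl) = refl
  stuck-neighbour {a = a} (walk h (s ∷ ms) u ⊆F) _ fha | inj₂ (inj₁ refl) =
    ⊥-elim (F-acyclic h ((s ∷ ms) ∷ʳ a) (u , s≤s (0<length-∷ʳ ms)) cycle⊆F)
    where
    cycle⊆F : cycleEdges h ((s ∷ ms) ∷ʳ a) ⊆E F
    cycle⊆F x y e with to (cycleEdges-pathSeq h (s ∷ ms) a x y) e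
    ... | inj₁ e′                 = ⊆F x y e′
    ... | inj₂ (inj₁ (refl , refl)) = F-sym fha
    ... | inj₂ (inj₂ (refl , refl)) = fha
  stuck-neighbour (walk h (s ∷ ms) _ _) _ _ | inj₂ (inj₂ (here refl)) = refl
  stuck-neighbour (walk h (s ∷ ms) u@(_ ∷ u′) ⊆F) _ fhz | inj₂ (inj₂ (there z∈)) =
    ⊥-elim (Unique[x∷xs]⇒x∉xs u (walkEdges⇒∈ (walkEdges-sym z–h)))
    where
    z–h = pathSeq-inner-closed u′ (λ x y e → ⊆F x y (walkEdges-∷ e)) z∈ (F-sym fhz)

  stuck⇒head-leaf : (w : Walk a) → Stuck w → IsLeaf (head w)
  stuck⇒head-leaf w stuck fhb fhc = trans (stuck-neighbour w stuck fhb) (sym (stuck-neighbour w stuck fhc))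

  -- From a vertex outside T, walk away from T until stuck, at a leaf outside T; the maximal walk
  -- from that leaf ends in another leaf, so it is a whole component and hence lies inside T.
  module ComponentCover (spanning : ∀ v → v ∈V F) (T : List (Fin n))
    (T-closed : ∀ {u w} → u ∈ T → F u w → w ∈ T)
    (components⊆T : ∀ {P} → P ∈𝒫 F → ∀ {v} → v ∈V P → v ∈ T) where

    leaf-∈ : IsLeaf h → F h b → h ∈ T
    leaf-∈ {h} leaf fhb = decidable-stable (h ∈? T) λ h∉T →
      stuck-walk (λ _ → ⊤) _ (Walk-edge (F-sym fhb)) tt λ (w , stuck , _) →
        h∉T (components⊆T (leaf-path-component (unique w) (⊆F w) (stuck⇒head-leaf w stuck) leaf)
                           (∈pathSeq⇒∈V (unique w) ≐-refl (there (∈-++⁺ʳ (inner w) (here refl)))))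

    all-∈ : ∀ v → v ∈ T
    all-∈ v = decidable-stable (v ∈? T) λ v∉T →
      let w₀ , fvw₀ = spanning v in
      stuck-walk (_∉ T) (λ h∉T fhz z∈T → h∉T (T-closed z∈T (F-sym fhz)))
        (Walk-edge (F-sym fvw₀)) (λ w₀∈T → v∉T (T-closed w₀∈T (F-sym fvw₀)))
        λ (w , stuck , h∉T) →
          h∉T (leaf-∈ (stuck⇒head-leaf w stuck) (⊆F w _ _ (inj₁ (pathSeq-head-edge _ (inner w) _))))

-- Closing a path cover into a tour

module ConcatenatedTour {n : ℕ} {F : EdgeSet n} (cover : IsPathCover F) (k : ℕ) (1≤k : 1 ≤ k)
  (X Y : ℕ → Fin n) (P : ℕ → EdgeSet n)
  (P-path : ∀ {i} → i ≤ k → IsPath (X i) (Y i) (P i))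
  (P-disjoint : ∀ {i j} → i ≤ k → j ≤ k → i ≢ j → VDisjoint (P i) (P j))
  (components : ∀ Q → (Q ∈𝒫 F) ⇔ (∃[ i ] (i ≤ k × Q ≐ P i)))
  where

  private variable
    i j : ℕ
    u v w : Fin n

  pieces joins : ℕ → EdgeSet n
  pieces j u v = ∃[ i ] (i ≤ j × P i u v)
  joins  j u v = ∃[ i ] (i < j × E (Y i) (X (suc i)) u v)

  closingEdges : EdgeSet n
  closingEdges = joins k ∪E E (Y k) (X 0)

  chain : ℕ → EdgeSet n
  chain zero    = P 0
  chain (suc j) = chain j ∪E (E (Y j) (X (suc j)) ∪E P (suc j))

  P-same : i ≤ k → j ≤ k → v ∈V P i → v ∈V P j → i ≡ j
  P-same {i} {j} i≤k j≤k v∈i v∈j with i ℕₚ.≟ j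
  ... | yes i≡j = i≡j
  ... | no  i≢j = ⊥-elim (P-disjoint i≤k j≤k i≢j _ v∈i v∈j)

  P-component : i ≤ k → P i ∈𝒫 F
  P-component i≤k = from (components _) (_ , i≤k , ≐-refl)

  P⊆F : i ≤ k → P i u v → F u v
  P⊆F i≤k = proj₁ (proj₂ (P-component i≤k)) _ _

  P-closed : i ≤ k → v ∈V P i → F v w → P i v w
  P-closed i≤k v∈ = proj₂ (proj₂ (P-component i≤k)) _ _ v∈

  chain-vertices : j ≤ k → v ∈V chain j → ∃[ i ] (i ≤ j × v ∈V P i)
  chain-vertices {zero}  _    v∈              = 0 , z≤n , v∈
  chain-vertices {suc j} sj≤k (w , inj₁ e) =
    let i , i≤j , v∈ = chain-vertices (<⇒≤ sj≤k) (w , e) in i , m≤n⇒m≤1+n i≤j , v∈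
  chain-vertices {suc j} sj≤k (_ , inj₂ (inj₁ (inj₁ (refl , _)))) = j , n≤1+n j , IsPath-last∈V (P-path (<⇒≤ sj≤k))
  chain-vertices {suc j} sj≤k (_ , inj₂ (inj₁ (inj₂ (refl , _)))) = suc j , ≤-refl , IsPath-head∈V (P-path sj≤k)
  chain-vertices {suc j} _    (w , inj₂ (inj₂ e))                = suc j , ≤-refl , (w , e)

  chain-path : j ≤ k → IsPath (X 0) (Y j) (chain j)
  chain-path {zero}  _    = P-path z≤n
  chain-path {suc j} sj≤k = IsPath-∪ (chain-path j≤k) (IsPath-∪ (IsPath-edge Yj≢Xsj) (P-path sj≤k) edge-shared) shared
    where
    j≤k = <⇒≤ sj≤k
    not-later : i ≤ j → v ∈V P i → ¬ v ∈V P (suc j)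
    not-later {i} i≤j v∈i v∈sj with P-same (≤-trans i≤j j≤k) sj≤k v∈i v∈sj
    ... | refl = 1+n≰n i≤j
    Yj≢Xsj : Y j ≢ X (suc j)
    Yj≢Xsj Yj≡Xsj = not-later ≤-refl (IsPath-last∈V (P-path j≤k))
                      (subst (_∈V P (suc j)) (sym Yj≡Xsj) (IsPath-head∈V (P-path sj≤k)))
    edge-shared : ∀ v → v ∈V E (Y j) (X (suc j)) → v ∈V P (suc j) → v ≡ X (suc j)
    edge-shared v v∈E v∈sj with ∈V-E v∈E
    ... | inj₁ refl = ⊥-elim (not-later ≤-refl (IsPath-last∈V (P-path j≤k)) v∈sj)
    ... | inj₂ v≡X  = v≡X
    shared : ∀ v → v ∈V chain j → v ∈V (E (Y j) (X (suc j)) ∪E P (suc j)) → v ≡ Y j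
    shared v v∈chain (w , e) with chain-vertices j≤k v∈chain
    ... | i , i≤j , v∈i with e
    ...   | inj₂ e′ = ⊥-elim (not-later i≤j v∈i (w , e′))
    ...   | inj₁ e′ with ∈V-E (w , e′)
    ...     | inj₁ v≡Y = v≡Y
    ...     | inj₂ refl = ⊥-elim (not-later i≤j v∈i (IsPath-head∈V (P-path sj≤k)))

  chain-edges : ∀ j → chain j ≐ (pieces j ∪E joins j)
  chain-edges j u v = mk⇔ (to′ j) (from′ j)
    where
    to′ : ∀ j → chain j u v → (pieces j ∪E joins j) u v
    to′ zero    p                = inj₁ (0 , z≤n , p)
    to′ (suc j) (inj₂ (inj₁ e)) = inj₂ (j , ≤-refl , e)
    to′ (suc j) (inj₂ (inj₂ p)) = inj₁ (suc j , ≤-refl , p)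
    to′ (suc j) (inj₁ c) with to′ j c
    ... | inj₁ (i , i≤j , p) = inj₁ (i , m≤n⇒m≤1+n i≤j , p)
    ... | inj₂ (i , i<j , e) = inj₂ (i , m≤n⇒m≤1+n i<j , e)
    from′ : ∀ j → (pieces j ∪E joins j) u v → chain j u v
    from′ zero    (inj₁ (_ , z≤n , p)) = p
    from′ (suc j) (inj₁ (i , i≤sj , p)) with m≤n⇒m<n∨m≡n i≤sj
    ... | inj₁ i<sj = inj₁ (from′ j (inj₁ (i , ≤-pred i<sj , p)))
    ... | inj₂ refl = inj₂ (inj₂ p)
    from′ (suc j) (inj₂ (i , i<sj , e)) with m≤n⇒m<n∨m≡n (≤-pred i<sj)
    ... | inj₁ i<j  = inj₁ (from′ j (inj₂ (i , i<j , e)))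
    ... | inj₂ refl = inj₂ (inj₁ e)

  private
    hamiltonian = chain-path ≤-refl
    mid = proj₁ hamiltonian
    T = pathSeq (X 0) mid (Y k)
    T-unique = proj₁ (proj₂ hamiltonian)
    T-edges = proj₂ (proj₂ hamiltonian)

    ∈V-chain⇒∈T : v ∈V chain k → v ∈ T
    ∈V-chain⇒∈T = ∈V⇒∈ T-edges

    ∈T⇒∈V-P : v ∈ T → ∃[ i ] (i ≤ k × v ∈V P i)
    ∈T⇒∈V-P v∈ = chain-vertices ≤-refl (∈pathSeq⇒∈V T-unique T-edges v∈)

    ∈V-P⇒∈T : i ≤ k → v ∈V P i → v ∈ T
    ∈V-P⇒∈T {i} i≤k (w , p) = ∈V-chain⇒∈T (w , from (chain-edges k _ w) (inj₁ (i , i≤k , p)))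

  all-∈T : ∀ v → v ∈ T
  all-∈T = ComponentCover.all-∈ (proj₁ cover) (proj₂ cover) T T-closed components⊆T
    where
    T-closed : u ∈ T → F u w → w ∈ T
    T-closed u∈ fuw =
      let i , i≤k , u∈i = ∈T⇒∈V-P u∈
      in ∈V-P⇒∈T i≤k (_ , IsPath-sym (P-path i≤k) (P-closed i≤k u∈i fuw))
    components⊆T : ∀ {Q} → Q ∈𝒫 F → ∀ {v} → v ∈V Q → v ∈ T
    components⊆T {Q} Q∈ (w , q) = let i , i≤k , Q≐ = to (components Q) Q∈ in ∈V-P⇒∈T i≤k (w , to (Q≐ _ w) q)

  F⊆pieces : F u v → pieces k u v
  F⊆pieces fuv = let i , i≤k , u∈ = ∈T⇒∈V-P (all-∈T _) in i , i≤k , P-closed i≤k u∈ fuv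

  tour : IsTour (F ∪E closingEdges)
  tour = X 0 , mid ∷ʳ Y k , (T-unique , length≥2) , all-∈T , edges
    where
    Y₀∈mid : Y 0 ∈ mid
    Y₀∈mid with pathSeq-∈ (∈V-P⇒∈T z≤n (IsPath-last∈V (P-path z≤n)))
    ... | inj₁ Y₀≡X₀         = ⊥-elim (IsPath⇒≢ (P-path z≤n) (sym Y₀≡X₀))
    ... | inj₂ (inj₂ Y₀∈)   = Y₀∈
    ... | inj₂ (inj₁ Y₀≡Yₖ) with P-same z≤n ≤-refl (IsPath-last∈V (P-path z≤n))
                                  (subst (_∈V P k) (sym Y₀≡Yₖ) (IsPath-last∈V (P-path ≤-refl)))
    ...   | 0≡k = ⊥-elim (1+n≰n (subst (1 ≤_) (sym 0≡k) 1≤k))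
    length≥2 : 2 ≤ length (mid ∷ʳ Y k)
    length≥2 with mid | Y₀∈mid
    ... | _ ∷ ms | _ = s≤s (0<length-∷ʳ ms)
    edges : (F ∪E closingEdges) ≐ cycleEdges (X 0) (mid ∷ʳ Y k)
    edges u v = mk⇔ to′ from′
      where
      cycle = cycleEdges-pathSeq (X 0) mid (Y k) u v
      to′ : (F ∪E closingEdges) u v → cycleEdges (X 0) (mid ∷ʳ Y k) u v
      to′ (inj₁ fuv)        = from cycle (inj₁ (to (T-edges u v) (from (chain-edges k u v) (inj₁ (F⊆pieces fuv)))))
      to′ (inj₂ (inj₁ j))   = from cycle (inj₁ (to (T-edges u v) (from (chain-edges k u v) (inj₂ j))))
      to′ (inj₂ (inj₂ e))   = from cycle (inj₂ e)
      from′ : cycleEdges (X 0) (mid ∷ʳ Y k) u v → (F ∪E closingEdges) u v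
      from′ c with to cycle c
      ... | inj₂ e = inj₂ (inj₂ e)
      ... | inj₁ t with to (chain-edges k u v) (from (T-edges u v) t)
      ...   | inj₁ (_ , i≤k , p) = inj₁ (P⊆F i≤k p)
      ...   | inj₂ j             = inj₂ (inj₁ j)

  private
    V₁-P⇒V₁-F : i ≤ k → v ∈V₁ P i → v ∈V₁ F
    V₁-P⇒V₁-F i≤k (c , pvc , only) = c , P⊆F i≤k pvc , λ b fvb → only b (P-closed i≤k (c , pvc) fvb)

    V₁-F⇒V₁-P : i ≤ k → v ∈V P i → v ∈V₁ F → v ∈V₁ P i
    V₁-F⇒V₁-P i≤k (c , pvc) (_ , _ , only) =
      c , pvc , λ b pvb → trans (only b (P⊆F i≤k pvb)) (sym (only c (P⊆F i≤k pvc)))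

  closingEdges-vertices : ∀ v → (v ∈V closingEdges) ⇔ (v ∈V₁ F)
  closingEdges-vertices v = mk⇔ to′ from′
    where
    to′ : v ∈V closingEdges → v ∈V₁ F
    to′ (_ , inj₁ (i , i<k , inj₁ (refl , refl))) = V₁-P⇒V₁-F (<⇒≤ i<k) (IsPath-last-V₁ (P-path (<⇒≤ i<k)))
    to′ (_ , inj₁ (i , i<k , inj₂ (refl , refl))) = V₁-P⇒V₁-F i<k (IsPath-head-V₁ (P-path i<k))
    to′ (_ , inj₂ (inj₁ (refl , refl)))          = V₁-P⇒V₁-F ≤-refl (IsPath-last-V₁ (P-path ≤-refl))
    to′ (_ , inj₂ (inj₂ (refl , refl)))          = V₁-P⇒V₁-F z≤n (IsPath-head-V₁ (P-path z≤n))
    end⇒closing : ∀ i → i ≤ k → v ≡ X i ⊎ v ≡ Y i → v ∈V closingEdges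
    end⇒closing zero    _    (inj₁ refl) = Y k , inj₂ (inj₂ (refl , refl))
    end⇒closing (suc i) si≤k (inj₁ refl) = Y i , inj₁ (i , si≤k , inj₂ (refl , refl))
    end⇒closing i       i≤k  (inj₂ refl) with m≤n⇒m<n∨m≡n i≤k
    ... | inj₁ i<k  = X (suc i) , inj₁ (i , i<k , inj₁ (refl , refl))
    ... | inj₂ refl = X 0 , inj₂ (inj₁ (refl , refl))
    from′ : v ∈V₁ F → v ∈V closingEdges
    from′ v∈V₁ = let i , i≤k , v∈ = ∈T⇒∈V-P (all-∈T v)
                 in end⇒closing i i≤k (IsPath-V₁⇒end (P-path i≤k) (V₁-F⇒V₁-P i≤k v∈ v∈V₁))

module _ {ℓ} {A : Set ℓ} where

  [0↦_]_ : A → (ℕ → A) → ℕ → A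
  ([0↦ a ] f) zero    = a
  ([0↦ a ] f) (suc i) = f (suc i)

A₁-completes-cover : ∀ {n} {F : EdgeSet n} (k′ : ℕ) {a b : Fin n} {x y : ℕ → Fin n} {P₀ : EdgeSet n} {Q : ℕ → EdgeSet n} →
  IsPathCover F → IsPath a b P₀ →
  (∀ i → 1 ≤ i → i ≤ suc k′ → IsPath (x i) (y i) (Q i)) →
  (∀ i → 1 ≤ i → i ≤ suc k′ → VDisjoint P₀ (Q i)) →
  (∀ i j → 1 ≤ i → i ≤ suc k′ → 1 ≤ j → j ≤ suc k′ → i ≢ j → VDisjoint (Q i) (Q j)) →
  (∀ P → (P ∈𝒫 F) ⇔ (P ≐ P₀ ⊎ ∃[ i ] (1 ≤ i × i ≤ suc k′ × P ≐ Q i))) →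
  IsTour (F ∪E A₁ a b (suc k′) x y) × (∀ v → (v ∈V A₁ a b (suc k′) x y) ⇔ (v ∈V₁ F))
A₁-completes-cover {n} {F} k′ {a} {b} {x} {y} {P₀} {Q} cover P₀-path Q-path P₀-disjoint Q-disjoint components =
  IsTour-resp (∪E-congˡ (≐-sym A₁≐closing)) tour ,
  λ v → ⇔.trans (mk⇔ (∈V-resp A₁≐closing) (∈V-resp (≐-sym A₁≐closing))) (closingEdges-vertices v)
  where
  P : ℕ → EdgeSet n
  P = [0↦ P₀ ] Q

  path : ∀ {i} → i ≤ suc k′ → IsPath (([0↦ a ] x) i) (([0↦ b ] y) i) (P i)
  path {zero}  _    = P₀-path
  path {suc i} i≤k = Q-path (suc i) (s≤s z≤n) i≤k

  disjoint : ∀ {i j} → i ≤ suc k′ → j ≤ suc k′ → i ≢ j → VDisjoint (P i) (P j)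
  disjoint {zero}  {zero}  _   _   0≢0 = ⊥-elim (0≢0 refl)
  disjoint {zero}  {suc j} _   j≤k _   = P₀-disjoint (suc j) (s≤s z≤n) j≤k
  disjoint {suc i} {zero}  i≤k _   _   = λ v v∈Q v∈P₀ → P₀-disjoint (suc i) (s≤s z≤n) i≤k v v∈P₀ v∈Q
  disjoint {suc i} {suc j} i≤k j≤k i≢j = Q-disjoint (suc i) (suc j) (s≤s z≤n) i≤k (s≤s z≤n) j≤k i≢j

  indexed : ∀ R → (R ∈𝒫 F) ⇔ (∃[ i ] (i ≤ suc k′ × R ≐ P i))
  indexed R = ⇔.trans (components R) (mk⇔ to′ from′)
    where
    to′ : R ≐ P₀ ⊎ ∃[ i ] (1 ≤ i × i ≤ suc k′ × R ≐ Q i) → ∃[ i ] (i ≤ suc k′ × R ≐ P i)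
    to′ (inj₁ R≐P₀)                        = zero , z≤n , R≐P₀
    to′ (inj₂ (suc i , _ , i≤k , R≐Q))     = suc i , i≤k , R≐Q
    from′ : ∃[ i ] (i ≤ suc k′ × R ≐ P i) → R ≐ P₀ ⊎ ∃[ i ] (1 ≤ i × i ≤ suc k′ × R ≐ Q i)
    from′ (zero , _ , R≐P₀)     = inj₁ R≐P₀
    from′ (suc i , i≤k , R≐Q) = inj₂ (suc i , s≤s z≤n , i≤k , R≐Q)

  open ConcatenatedTour cover (suc k′) (s≤s z≤n) ([0↦ a ] x) ([0↦ b ] y) P path disjoint indexed

  A₁≐closing : A₁ a b (suc k′) x y ≐ closingEdges
  A₁≐closing u v = mk⇔ to′ from′
    where
    to′ : A₁ a b (suc k′) x y u v → closingEdges u v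
    to′ (inj₁ e)                              = inj₁ (zero , s≤s z≤n , e)
    to′ (inj₂ (inj₁ (suc i , _ , i<k , e)))  = inj₁ (suc i , i<k , e)
    to′ (inj₂ (inj₂ e))                       = inj₂ e
    from′ : closingEdges u v → A₁ a b (suc k′) x y u v
    from′ (inj₁ (zero , _ , e))      = inj₁ e
    from′ (inj₁ (suc i , i<k , e)) = inj₂ (inj₁ (suc i , s≤s z≤n , i<k , e))
    from′ (inj₂ e)                   = inj₂ (inj₂ e)

-- The two alternating paths of A₁ ∪ A₂

module Zigzag {n : ℕ} (p₁ p₂ p₃ p₄ : Fin n) (k′ : ℕ) (x y : ℕ → Fin n)
  (OnC : Fin n → Set) (p₁∈C : OnC p₁) (p₂∈C : OnC p₂) (p₃∈C : OnC p₃) (p₄∈C : OnC p₄)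
  (end∉C : ∀ {i v} → 1 ≤ i → i ≤ suc k′ → OnC v → v ≡ x i ⊎ v ≡ y i → ⊥)
  (end-index : ∀ {i j v} → 1 ≤ i → i ≤ suc k′ → 1 ≤ j → j ≤ suc k′ →
               v ≡ x i ⊎ v ≡ y i → v ≡ x j ⊎ v ≡ y j → i ≡ j)
  (x≢y : ∀ {i} → 1 ≤ i → i ≤ suc k′ → x i ≢ y i)
  (p₁≢p₂ : p₁ ≢ p₂) (p₃≢p₄ : p₃ ≢ p₄) (p₁≢p₃ : p₁ ≢ p₃) (p₁≢p₄ : p₁ ≢ p₄) (p₄≢p₂ : p₄ ≢ p₂)
  where

  k : ℕ
  k = suc k′

  private variable
    b : Bool
    i j m : ℕ
    u v : Fin n

  End : ℕ → Fin n → Set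
  End i v = v ≡ x i ⊎ v ≡ y i

  pick : Bool → ℕ → Fin n
  pick true  = x
  pick false = y

  pick-End : ∀ b i → End i (pick b i)
  pick-End true  _ = inj₁ refl
  pick-End false _ = inj₂ refl

  terminal : Bool → Fin n
  terminal true  = p₁
  terminal false = p₄

  alternating : Bool → ℕ → ℕ → List (Fin n)
  alternating _ _ zero    = []
  alternating b i (suc m) = pick b i ∷ alternating (not b) (suc i) m

  finalTerminal : Bool → ℕ → Fin n
  finalTerminal b zero    = terminal b
  finalTerminal b (suc m) = finalTerminal (not b) m

  zigzag : Bool → ℕ → ℕ → List (Fin n)
  zigzag b i m = alternating b i m ∷ʳ finalTerminal b m

  finalTerminal-even : ∀ b m → 2 ∣ m → finalTerminal b m ≡ terminal b
  finalTerminal-even _     zero          _   = refl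
  finalTerminal-even _     (suc zero)    2∣1 = contradiction (∣1⇒≡1 2∣1) λ ()
  finalTerminal-even true  (suc (suc m)) 2∣m = finalTerminal-even true  m (∣m+n∣m⇒∣n 2∣m ∣-refl)
  finalTerminal-even false (suc (suc m)) 2∣m = finalTerminal-even false m (∣m+n∣m⇒∣n 2∣m ∣-refl)

  finalTerminal-odd : ∀ b m → ¬ 2 ∣ m → finalTerminal b m ≡ terminal (not b)
  finalTerminal-odd _     zero          2∤0 = contradiction (divides 0 refl) 2∤0
  finalTerminal-odd _     (suc zero)    _   = refl
  finalTerminal-odd true  (suc (suc m)) 2∤m = finalTerminal-odd true  m (2∤m ∘ ∣m∣n⇒∣m+n ∣-refl)
  finalTerminal-odd false (suc (suc m)) 2∤m = finalTerminal-odd false m (2∤m ∘ ∣m∣n⇒∣m+n ∣-refl)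

  finalTerminal-∈C : ∀ b m → finalTerminal b m ≡ p₁ ⊎ finalTerminal b m ≡ p₄
  finalTerminal-∈C true  zero    = inj₁ refl
  finalTerminal-∈C false zero    = inj₂ refl
  finalTerminal-∈C b     (suc m) = finalTerminal-∈C (not b) m

  zigzag-∈ : ∀ b i m → v ∈ zigzag b i m → (∃[ j ] (i ≤ j × j < i + m × End j v)) ⊎ (v ≡ p₁ ⊎ v ≡ p₄)
  zigzag-∈ b i zero    (here refl) = inj₂ (finalTerminal-∈C b zero)
  zigzag-∈ b i (suc m) (here refl) = inj₁ (i , ≤-refl , subst (i <_) (sym (+-suc i m)) (s≤s (m≤m+n i m)) , pick-End b i)
  zigzag-∈ b i (suc m) (there v∈) with zigzag-∈ (not b) (suc i) m v∈
  ... | inj₁ (j , i<j , j<i+m , e) = inj₁ (j , <⇒≤ i<j , subst (j <_) (sym (+-suc i m)) j<i+m , e)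
  ... | inj₂ v∈C                    = inj₂ v∈C

  private
    index-range : 1 ≤ i → i + m ≤ suc k → i ≤ j → j < i + m → 1 ≤ j × j ≤ k
    index-range 1≤i i+m≤ i≤j j<i+m = ≤-trans 1≤i i≤j , ≤-pred (≤-trans j<i+m i+m≤)

    head-range : i + suc m ≤ suc k → i ≤ k
    head-range {i} {m} le = ≤-pred (≤-trans (subst (suc i ≤_) (sym (+-suc i m)) (s≤s (m≤m+n i m))) le)

    tail-range : i + suc m ≤ suc k → suc i + m ≤ suc k
    tail-range {i} {m} = subst (_≤ suc k) (+-suc i m)

  ∉zigzag : ∀ b i m → 1 ≤ i → i + m ≤ suc k → OnC v → v ≢ p₁ → v ≢ p₄ → v ∉ zigzag b i m
  ∉zigzag b i m 1≤i le v∈C v≢p₁ v≢p₄ v∈ with zigzag-∈ b i m v∈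
  ... | inj₁ (j , i≤j , j<i+m , e) = let 1≤j , j≤k = index-range 1≤i le i≤j j<i+m in end∉C 1≤j j≤k v∈C e
  ... | inj₂ (inj₁ v≡p₁) = v≢p₁ v≡p₁
  ... | inj₂ (inj₂ v≡p₄) = v≢p₄ v≡p₄

  pick-∉-later : ∀ b b′ i m → 1 ≤ i → i + suc m ≤ suc k → pick b i ∉ zigzag b′ (suc i) m
  pick-∉-later b b′ i m 1≤i le v∈ with zigzag-∈ b′ (suc i) m v∈
  ... | inj₁ (j , i<j , j<i+m , e) =
    let 1≤j , j≤k = index-range (s≤s z≤n) (tail-range le) i<j j<i+m
    in 1+n≰n (subst (λ t → suc t ≤ j) (end-index 1≤i (head-range le) 1≤j j≤k (pick-End b i) e) i<j)
  ... | inj₂ (inj₁ e) = end∉C 1≤i (head-range le) p₁∈C (subst (End i) e (pick-End b i))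
  ... | inj₂ (inj₂ e) = end∉C 1≤i (head-range le) p₄∈C (subst (End i) e (pick-End b i))

  zigzag-unique : ∀ b i m → 1 ≤ i → i + m ≤ suc k → Unique (zigzag b i m)
  zigzag-unique b i zero    _   _  = [] ∷ []
  zigzag-unique b i (suc m) 1≤i le =
    Unique-∷ (pick-∉-later b (not b) i m 1≤i le) (zigzag-unique (not b) (suc i) m (s≤s z≤n) (tail-range le))

  zigzag-disjoint : ∀ b i m → 1 ≤ i → i + m ≤ suc k → v ∈ zigzag b i m → v ∉ zigzag (not b) i m
  zigzag-disjoint true  i zero    _   _  (here refl) (here e) = p₁≢p₄ e
  zigzag-disjoint false i zero    _   _  (here refl) (here e) = p₁≢p₄ (sym e)
  zigzag-disjoint true  i (suc m) 1≤i le (here refl) (here e) = x≢y 1≤i (head-range le) e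
  zigzag-disjoint false i (suc m) 1≤i le (here refl) (here e) = x≢y 1≤i (head-range le) (sym e)
  zigzag-disjoint b     i (suc m) 1≤i le (here refl) (there v∈) = pick-∉-later b _ i m 1≤i le v∈
  zigzag-disjoint b     i (suc m) 1≤i le (there v∈) (here refl) = pick-∉-later (not b) _ i m 1≤i le v∈
  zigzag-disjoint true  i (suc m) 1≤i le (there v∈) (there v∈′) =
    zigzag-disjoint false (suc i) m (s≤s z≤n) (tail-range le) v∈ v∈′
  zigzag-disjoint false i (suc m) 1≤i le (there v∈) (there v∈′) =
    zigzag-disjoint true (suc i) m (s≤s z≤n) (tail-range le) v∈ v∈′

  Step : ℕ → Fin n → Fin n → Set
  Step j u v = (u ≡ x j × v ≡ y (suc j)) ⊎ (u ≡ y j × v ≡ x (suc j))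

  ZigzagArc : ℕ → ℕ → Fin n → Fin n → Set
  ZigzagArc i m u v =
    (∃[ j ] (i ≤ j × j < i + m × Step j u v)) ⊎ (u ≡ x (i + m) × v ≡ p₄) ⊎ (u ≡ y (i + m) × v ≡ p₁)

  ZigzagConsec : ℕ → ℕ → Fin n → Fin n → Set
  ZigzagConsec i m u v = Consec (zigzag true i m) u v ⊎ Consec (zigzag false i m) u v

  private
    ZigzagArc-shift : ZigzagArc (suc i) m u v → ZigzagArc i (suc m) u v
    ZigzagArc-shift {i} {m} (inj₁ (j , i<j , j<i+m , s)) = inj₁ (j , <⇒≤ i<j , subst (j <_) (sym (+-suc i m)) j<i+m , s)
    ZigzagArc-shift {i} {m} (inj₂ (inj₁ (eu , ev))) = inj₂ (inj₁ (trans eu (cong x (sym (+-suc i m))) , ev))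
    ZigzagArc-shift {i} {m} (inj₂ (inj₂ (eu , ev))) = inj₂ (inj₂ (trans eu (cong y (sym (+-suc i m))) , ev))

    ZigzagConsec-shift : ZigzagConsec (suc i) (suc m) u v → ZigzagConsec i (suc (suc m)) u v
    ZigzagConsec-shift (inj₁ c) = inj₂ (there c)
    ZigzagConsec-shift (inj₂ c) = inj₁ (there c)

  zigzag-arcs⁻ : ∀ i m → ZigzagConsec i (suc m) u v → ZigzagArc i m u v
  zigzag-arcs⁻ i zero    (inj₁ here)      = inj₂ (inj₁ (cong x (sym (+-identityʳ i)) , refl))
  zigzag-arcs⁻ i zero    (inj₂ here)      = inj₂ (inj₂ (cong y (sym (+-identityʳ i)) , refl))
  zigzag-arcs⁻ i zero    (inj₁ (there c)) = ⊥-elim (¬Consec-[ _ ] c)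
  zigzag-arcs⁻ i zero    (inj₂ (there c)) = ⊥-elim (¬Consec-[ _ ] c)
  zigzag-arcs⁻ i (suc m) (inj₁ here)      = inj₁ (i , ≤-refl , m<m+n i (s≤s z≤n) , inj₁ (refl , refl))
  zigzag-arcs⁻ i (suc m) (inj₂ here)      = inj₁ (i , ≤-refl , m<m+n i (s≤s z≤n) , inj₂ (refl , refl))
  zigzag-arcs⁻ i (suc m) (inj₁ (there c)) = ZigzagArc-shift (zigzag-arcs⁻ (suc i) m (inj₂ c))
  zigzag-arcs⁻ i (suc m) (inj₂ (there c)) = ZigzagArc-shift (zigzag-arcs⁻ (suc i) m (inj₁ c))

  zigzag-arcs⁺ : ∀ i m → ZigzagArc i m u v → ZigzagConsec i (suc m) u v
  zigzag-arcs⁺ i zero (inj₁ (j , i≤j , j<i+0 , _)) =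
    ⊥-elim (1+n≰n (≤-trans (subst (j <_) (+-identityʳ i) j<i+0) i≤j))
  zigzag-arcs⁺ i zero (inj₂ (inj₁ (eu , ev))) = inj₁ (Consec-here (trans eu (cong x (+-identityʳ i))) ev)
  zigzag-arcs⁺ i zero (inj₂ (inj₂ (eu , ev))) = inj₂ (Consec-here (trans eu (cong y (+-identityʳ i))) ev)
  zigzag-arcs⁺ i (suc m) (inj₁ (j , i≤j , j<i+m , s)) with j ℕₚ.≟ i | s
  ... | yes refl | inj₁ (eu , ev) = inj₁ (Consec-here eu ev)
  ... | yes refl | inj₂ (eu , ev) = inj₂ (Consec-here eu ev)
  ... | no j≢i   | _              =
    ZigzagConsec-shift (zigzag-arcs⁺ (suc i) m (inj₁ (j , ≤∧≢⇒< i≤j (j≢i ∘ sym) , subst (j <_) (+-suc i m) j<i+m , s)))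
  zigzag-arcs⁺ i (suc m) (inj₂ (inj₁ (eu , ev))) =
    ZigzagConsec-shift (zigzag-arcs⁺ (suc i) m (inj₂ (inj₁ (trans eu (cong x (+-suc i m)) , ev))))
  zigzag-arcs⁺ i (suc m) (inj₂ (inj₂ (eu , ev))) =
    ZigzagConsec-shift (zigzag-arcs⁺ (suc i) m (inj₂ (inj₂ (trans eu (cong y (+-suc i m)) , ev))))

  -- Λ₁ = p₂, x₁, y₂, x₃, … and Λ₂ = p₃, y₁, x₂, y₃, …, each ending in p₁ or p₄.
  Λ₁ Λ₂ : List (Fin n)
  Λ₁ = p₂ ∷ zigzag true 1 k
  Λ₂ = p₃ ∷ zigzag false 1 k

  Arc₁ Arc₂ : Fin n → Fin n → Set
  Arc₁ u v = (u ≡ p₂ × v ≡ x 1) ⊎ (∃[ i ] (1 ≤ i × i < k × u ≡ y i × v ≡ x (suc i))) ⊎ (u ≡ y k × v ≡ p₁)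
  Arc₂ u v = (u ≡ p₃ × v ≡ y 1) ⊎ (∃[ i ] (1 ≤ i × i < k × u ≡ x i × v ≡ y (suc i))) ⊎ (u ≡ x k × v ≡ p₄)

  A₁-arcs : A₁ p₁ p₂ k x y u v ⇔ (Arc₁ u v ⊎ Arc₁ v u)
  A₁-arcs = mk⇔ to′ from′
    where
    to′ : A₁ p₁ p₂ k x y u v → Arc₁ u v ⊎ Arc₁ v u
    to′ (inj₁ (inj₁ e))                    = inj₁ (inj₁ e)
    to′ (inj₁ (inj₂ (eu , ev)))            = inj₂ (inj₁ (ev , eu))
    to′ (inj₂ (inj₁ (i , r , r′ , inj₁ e))) = inj₁ (inj₂ (inj₁ (i , r , r′ , e)))
    to′ (inj₂ (inj₁ (i , r , r′ , inj₂ (eu , ev)))) = inj₂ (inj₂ (inj₁ (i , r , r′ , ev , eu)))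
    to′ (inj₂ (inj₂ (inj₁ e)))             = inj₁ (inj₂ (inj₂ e))
    to′ (inj₂ (inj₂ (inj₂ (eu , ev))))     = inj₂ (inj₂ (inj₂ (ev , eu)))
    from′ : Arc₁ u v ⊎ Arc₁ v u → A₁ p₁ p₂ k x y u v
    from′ (inj₁ (inj₁ e))                          = inj₁ (inj₁ e)
    from′ (inj₂ (inj₁ (ev , eu)))                  = inj₁ (inj₂ (eu , ev))
    from′ (inj₁ (inj₂ (inj₁ (i , r , r′ , e))))     = inj₂ (inj₁ (i , r , r′ , inj₁ e))
    from′ (inj₂ (inj₂ (inj₁ (i , r , r′ , ev , eu)))) = inj₂ (inj₁ (i , r , r′ , inj₂ (eu , ev)))
    from′ (inj₁ (inj₂ (inj₂ e)))                   = inj₂ (inj₂ (inj₁ e))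
    from′ (inj₂ (inj₂ (inj₂ (ev , eu))))           = inj₂ (inj₂ (inj₂ (eu , ev)))

  A₂-arcs : A₂ p₃ p₄ k x y u v ⇔ (Arc₂ u v ⊎ Arc₂ v u)
  A₂-arcs = mk⇔ to′ from′
    where
    to′ : A₂ p₃ p₄ k x y u v → Arc₂ u v ⊎ Arc₂ v u
    to′ (inj₁ (inj₁ e))                    = inj₁ (inj₁ e)
    to′ (inj₁ (inj₂ (eu , ev)))            = inj₂ (inj₁ (ev , eu))
    to′ (inj₂ (inj₁ (i , r , r′ , inj₁ e))) = inj₁ (inj₂ (inj₁ (i , r , r′ , e)))
    to′ (inj₂ (inj₁ (i , r , r′ , inj₂ (eu , ev)))) = inj₂ (inj₂ (inj₁ (i , r , r′ , ev , eu)))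
    to′ (inj₂ (inj₂ (inj₁ e)))             = inj₁ (inj₂ (inj₂ e))
    to′ (inj₂ (inj₂ (inj₂ (eu , ev))))     = inj₂ (inj₂ (inj₂ (ev , eu)))
    from′ : Arc₂ u v ⊎ Arc₂ v u → A₂ p₃ p₄ k x y u v
    from′ (inj₁ (inj₁ e))                          = inj₁ (inj₁ e)
    from′ (inj₂ (inj₁ (ev , eu)))                  = inj₁ (inj₂ (eu , ev))
    from′ (inj₁ (inj₂ (inj₁ (i , r , r′ , e))))     = inj₂ (inj₁ (i , r , r′ , inj₁ e))
    from′ (inj₂ (inj₂ (inj₁ (i , r , r′ , ev , eu)))) = inj₂ (inj₁ (i , r , r′ , inj₂ (eu , ev)))
    from′ (inj₁ (inj₂ (inj₂ e)))                   = inj₂ (inj₂ (inj₁ e))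
    from′ (inj₂ (inj₂ (inj₂ (ev , eu))))           = inj₂ (inj₂ (inj₂ (eu , ev)))

  Λ-arcs : (Consec Λ₁ u v ⊎ Consec Λ₂ u v) ⇔ (Arc₁ u v ⊎ Arc₂ u v)
  Λ-arcs = mk⇔ to′ from′
    where
    classify : ZigzagArc 1 k′ u v → Arc₁ u v ⊎ Arc₂ u v
    classify (inj₁ (j , 1≤j , j<k , inj₁ e)) = inj₂ (inj₂ (inj₁ (j , 1≤j , j<k , e)))
    classify (inj₁ (j , 1≤j , j<k , inj₂ e)) = inj₁ (inj₂ (inj₁ (j , 1≤j , j<k , e)))
    classify (inj₂ (inj₁ e))                 = inj₂ (inj₂ (inj₂ e))
    classify (inj₂ (inj₂ e))                 = inj₁ (inj₂ (inj₂ e))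
    to′ : Consec Λ₁ u v ⊎ Consec Λ₂ u v → Arc₁ u v ⊎ Arc₂ u v
    to′ (inj₁ here)      = inj₁ (inj₁ (refl , refl))
    to′ (inj₂ here)      = inj₂ (inj₁ (refl , refl))
    to′ (inj₁ (there c)) = classify (zigzag-arcs⁻ 1 k′ (inj₁ c))
    to′ (inj₂ (there c)) = classify (zigzag-arcs⁻ 1 k′ (inj₂ c))
    lift : ZigzagArc 1 k′ u v → Consec Λ₁ u v ⊎ Consec Λ₂ u v
    lift a with zigzag-arcs⁺ 1 k′ a
    ... | inj₁ c = inj₁ (there c)
    ... | inj₂ c = inj₂ (there c)
    from′ : Arc₁ u v ⊎ Arc₂ u v → Consec Λ₁ u v ⊎ Consec Λ₂ u v
    from′ (inj₁ (inj₁ (eu , ev)))                 = inj₁ (Consec-here eu ev)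
    from′ (inj₂ (inj₁ (eu , ev)))                 = inj₂ (Consec-here eu ev)
    from′ (inj₁ (inj₂ (inj₁ (j , 1≤j , j<k , e)))) = lift (inj₁ (j , 1≤j , j<k , inj₂ e))
    from′ (inj₂ (inj₂ (inj₁ (j , 1≤j , j<k , e)))) = lift (inj₁ (j , 1≤j , j<k , inj₁ e))
    from′ (inj₁ (inj₂ (inj₂ e)))                  = lift (inj₂ (inj₂ e))
    from′ (inj₂ (inj₂ (inj₂ e)))                  = lift (inj₂ (inj₁ e))

  private
    interchange : ∀ {A B C D : Set} → (A ⊎ B) ⊎ (C ⊎ D) → (A ⊎ C) ⊎ (B ⊎ D)
    interchange (inj₁ (inj₁ a)) = inj₁ (inj₁ a)
    interchange (inj₁ (inj₂ b)) = inj₂ (inj₁ b)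
    interchange (inj₂ (inj₁ c)) = inj₁ (inj₂ c)
    interchange (inj₂ (inj₂ d)) = inj₂ (inj₂ d)

    ⊎-interchange : ∀ {A B C D : Set} → ((A ⊎ B) ⊎ (C ⊎ D)) ⇔ ((A ⊎ C) ⊎ (B ⊎ D))
    ⊎-interchange = mk⇔ interchange interchange

  A-walks : (A₁ p₁ p₂ k x y ∪E A₂ p₃ p₄ k x y) ≐ (walkEdges Λ₁ ∪E walkEdges Λ₂)
  A-walks u v = begin
    (A₁ p₁ p₂ k x y u v ⊎ A₂ p₃ p₄ k x y u v)                            ≈⟨ A₁-arcs ⊎-⇔ A₂-arcs ⟩
    ((Arc₁ u v ⊎ Arc₁ v u) ⊎ (Arc₂ u v ⊎ Arc₂ v u))                      ≈⟨ ⊎-interchange ⟩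
    ((Arc₁ u v ⊎ Arc₂ u v) ⊎ (Arc₁ v u ⊎ Arc₂ v u))                      ≈⟨ ⇔.sym (Λ-arcs ⊎-⇔ Λ-arcs) ⟩
    ((Consec Λ₁ u v ⊎ Consec Λ₂ u v) ⊎ (Consec Λ₁ v u ⊎ Consec Λ₂ v u))  ≈⟨ ⊎-interchange ⟩
    (walkEdges Λ₁ u v ⊎ walkEdges Λ₂ u v)                                ∎
    where open SetoidReasoning (⇔.⇔-setoid 0ℓ)

  private
    1≤k : 1 ≤ k
    1≤k = s≤s z≤n

    arcs-same-direction : Arc₁ u v → Arc₂ u v → ⊥
    arcs-same-direction (inj₁ (refl , refl)) (inj₁ (_ , x₁≡y₁))                     = x≢y ≤-refl 1≤k x₁≡y₁
    arcs-same-direction (inj₁ (refl , refl)) (inj₂ (inj₁ (j , 1≤j , j<k , p₂≡x , _))) = end∉C 1≤j (<⇒≤ j<k) p₂∈C (inj₁ p₂≡x)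
    arcs-same-direction (inj₁ (refl , refl)) (inj₂ (inj₂ (p₂≡x , _)))               = end∉C 1≤k ≤-refl p₂∈C (inj₁ p₂≡x)
    arcs-same-direction (inj₂ (inj₁ (i , 1≤i , i<k , refl , refl))) (inj₁ (y≡p₃ , _)) =
      end∉C 1≤i (<⇒≤ i<k) p₃∈C (inj₂ (sym y≡p₃))
    arcs-same-direction (inj₂ (inj₁ (i , 1≤i , i<k , refl , refl))) (inj₂ (inj₁ (j , 1≤j , j<k , y≡x , x≡y)))
      with end-index 1≤i (<⇒≤ i<k) 1≤j (<⇒≤ j<k) (inj₂ refl) (inj₁ y≡x)
    ... | refl = x≢y (s≤s z≤n) i<k x≡y
    arcs-same-direction (inj₂ (inj₁ (i , 1≤i , i<k , refl , refl))) (inj₂ (inj₂ (_ , x≡p₄))) =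
      end∉C (s≤s z≤n) i<k p₄∈C (inj₁ (sym x≡p₄))
    arcs-same-direction (inj₂ (inj₂ (refl , refl))) (inj₁ (_ , p₁≡y))                     = end∉C ≤-refl 1≤k p₁∈C (inj₂ p₁≡y)
    arcs-same-direction (inj₂ (inj₂ (refl , refl))) (inj₂ (inj₁ (j , 1≤j , j<k , _ , p₁≡y))) = end∉C (s≤s z≤n) j<k p₁∈C (inj₂ p₁≡y)
    arcs-same-direction (inj₂ (inj₂ (refl , refl))) (inj₂ (inj₂ (_ , p₁≡p₄)))              = p₁≢p₄ p₁≡p₄

    arcs-opposite : Arc₁ u v → Arc₂ v u → ⊥
    arcs-opposite (inj₁ (refl , refl)) (inj₁ (x≡p₃ , _))                          = end∉C ≤-refl 1≤k p₃∈C (inj₁ (sym x≡p₃))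
    arcs-opposite (inj₁ (refl , refl)) (inj₂ (inj₁ (j , 1≤j , j<k , _ , p₂≡y)))   = end∉C (s≤s z≤n) j<k p₂∈C (inj₂ p₂≡y)
    arcs-opposite (inj₁ (refl , refl)) (inj₂ (inj₂ (_ , p₂≡p₄)))                  = p₄≢p₂ (sym p₂≡p₄)
    arcs-opposite (inj₂ (inj₁ (i , 1≤i , i<k , refl , refl))) (inj₁ (x≡p₃ , _)) =
      end∉C (s≤s z≤n) i<k p₃∈C (inj₁ (sym x≡p₃))
    arcs-opposite (inj₂ (inj₁ (i , 1≤i , i<k , refl , refl))) (inj₂ (inj₁ (j , 1≤j , j<k , x≡x , y≡y)))
      with end-index (s≤s z≤n) i<k 1≤j (<⇒≤ j<k) (inj₁ refl) (inj₁ x≡x)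
         | end-index 1≤i (<⇒≤ i<k) (s≤s z≤n) j<k (inj₂ refl) (inj₂ y≡y)
    ... | refl | i≡2+i = m≢1+n+m i i≡2+i
    arcs-opposite (inj₂ (inj₁ (i , 1≤i , i<k , refl , refl))) (inj₂ (inj₂ (_ , y≡p₄))) =
      end∉C 1≤i (<⇒≤ i<k) p₄∈C (inj₂ (sym y≡p₄))
    arcs-opposite (inj₂ (inj₂ (refl , refl))) (inj₁ (p₁≡p₃ , _))                      = p₁≢p₃ p₁≡p₃
    arcs-opposite (inj₂ (inj₂ (refl , refl))) (inj₂ (inj₁ (j , 1≤j , j<k , p₁≡x , _))) = end∉C 1≤j (<⇒≤ j<k) p₁∈C (inj₁ p₁≡x)
    arcs-opposite (inj₂ (inj₂ (refl , refl))) (inj₂ (inj₂ (p₁≡x , _)))                = end∉C 1≤k ≤-refl p₁∈C (inj₁ p₁≡x)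

  A₁∩A₂-empty : EmptyE (A₁ p₁ p₂ k x y ∩E A₂ p₃ p₄ k x y)
  A₁∩A₂-empty u v (a₁ , a₂) with to A₁-arcs a₁ | to A₂-arcs a₂
  ... | inj₁ d₁ | inj₁ d₂ = arcs-same-direction d₁ d₂
  ... | inj₁ d₁ | inj₂ d₂ = arcs-opposite d₁ d₂
  ... | inj₂ d₁ | inj₁ d₂ = arcs-opposite d₁ d₂
  ... | inj₂ d₁ | inj₂ d₂ = arcs-same-direction d₁ d₂

  Λ₁-unique : Unique Λ₁
  Λ₁-unique = Unique-∷ (∉zigzag true 1 k ≤-refl ≤-refl p₂∈C (p₁≢p₂ ∘ sym) (p₄≢p₂ ∘ sym))
                       (zigzag-unique true 1 k ≤-refl ≤-refl)

  Λ₂-unique : Unique Λ₂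
  Λ₂-unique = Unique-∷ (∉zigzag false 1 k ≤-refl ≤-refl p₃∈C (p₁≢p₃ ∘ sym) p₃≢p₄)
                       (zigzag-unique false 1 k ≤-refl ≤-refl)

  Λ-shared : v ∈V walkEdges Λ₁ → v ∈V walkEdges Λ₂ → v ≡ p₂ × v ≡ p₃
  Λ-shared v∈₁ v∈₂ = shared (∈V⇒∈ ≐-refl v∈₁) (∈V⇒∈ ≐-refl v∈₂)
    where
    shared : v ∈ Λ₁ → v ∈ Λ₂ → v ≡ p₂ × v ≡ p₃
    shared (here refl) (here p₂≡p₃) = refl , p₂≡p₃
    shared (here refl) (there v∈)   = ⊥-elim (∉zigzag false 1 k ≤-refl ≤-refl p₂∈C (p₁≢p₂ ∘ sym) (p₄≢p₂ ∘ sym) v∈)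
    shared (there v∈)  (here refl)  = ⊥-elim (∉zigzag true 1 k ≤-refl ≤-refl p₃∈C (p₁≢p₃ ∘ sym) p₃≢p₄ v∈)
    shared (there v∈)  (there v∈′)  = ⊥-elim (zigzag-disjoint true 1 k ≤-refl ≤-refl v∈ v∈′)

  Λ₁-path : IsPath p₂ (finalTerminal true k) (walkEdges Λ₁)
  Λ₁-path = alternating true 1 k , Λ₁-unique , ≐-refl

  Λ₂-path : IsPath p₃ (finalTerminal false k) (walkEdges Λ₂)
  Λ₂-path = alternating false 1 k , Λ₂-unique , ≐-refl

  odd-paths : ¬ 2 ∣ k → IsPath p₁ p₃ (walkEdges Λ₂) × IsPath p₂ p₄ (walkEdges Λ₁)
  odd-paths k-odd =
    IsPath-reverse (subst (λ t → IsPath p₃ t (walkEdges Λ₂)) (finalTerminal-odd false k k-odd) Λ₂-path) ,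
    subst (λ t → IsPath p₂ t (walkEdges Λ₁)) (finalTerminal-odd true k k-odd) Λ₁-path

  even-paths : 2 ∣ k → IsPath p₁ p₂ (walkEdges Λ₁) × IsPath p₃ p₄ (walkEdges Λ₂)
  even-paths k-even =
    IsPath-reverse (subst (λ t → IsPath p₂ t (walkEdges Λ₁)) (finalTerminal-even true k k-even) Λ₁-path) ,
    subst (λ t → IsPath p₃ t (walkEdges Λ₂)) (finalTerminal-even false k k-even) Λ₂-path

  A-path : p₂ ≡ p₃ → IsPath p₁ p₄ (A₁ p₁ p₂ k x y ∪E A₂ p₃ p₄ k x y)
  A-path p₂≡p₃ with 2 ∣? k
  ... | no k-odd =
    let P₁₃ , P₂₄ = odd-paths k-odd
    in IsPath-resp (≐-sym (≐-trans A-walks ∪E-comm))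
         (IsPath-∪ P₁₃ (subst (λ t → IsPath t p₄ (walkEdges Λ₁)) p₂≡p₃ P₂₄) λ _ v∈₂ v∈₁ → proj₂ (Λ-shared v∈₁ v∈₂))
  ... | yes k-even =
    let P₁₂ , P₃₄ = even-paths k-even
    in IsPath-resp (≐-sym A-walks)
         (IsPath-∪ P₁₂ (subst (λ t → IsPath t p₄ (walkEdges Λ₂)) (sym p₂≡p₃) P₃₄) λ _ v∈₁ v∈₂ → proj₁ (Λ-shared v∈₁ v∈₂))

  private
    Λ-disjoint : p₂ ≢ p₃ → v ∈V walkEdges Λ₁ → ¬ v ∈V walkEdges Λ₂
    Λ-disjoint p₂≢p₃ v∈₁ v∈₂ = let v≡p₂ , v≡p₃ = Λ-shared v∈₁ v∈₂ in p₂≢p₃ (trans (sym v≡p₂) v≡p₃)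

  A-two-paths-odd : p₂ ≢ p₃ → ¬ 2 ∣ k →
    ∃[ P ] ∃[ P′ ] (IsPath p₁ p₃ P × IsPath p₂ p₄ P′ × VDisjoint P P′ × (A₁ p₁ p₂ k x y ∪E A₂ p₃ p₄ k x y) ≐ (P ∪E P′))
  A-two-paths-odd p₂≢p₃ k-odd =
    walkEdges Λ₂ , walkEdges Λ₁ , proj₁ (odd-paths k-odd) , proj₂ (odd-paths k-odd) ,
    (λ _ v∈₂ v∈₁ → Λ-disjoint p₂≢p₃ v∈₁ v∈₂) , ≐-trans A-walks ∪E-comm

  A-two-paths-even : p₂ ≢ p₃ → 2 ∣ k →
    ∃[ P ] ∃[ P′ ] (IsPath p₁ p₂ P × IsPath p₃ p₄ P′ × VDisjoint P P′ × (A₁ p₁ p₂ k x y ∪E A₂ p₃ p₄ k x y) ≐ (P ∪E P′))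
  A-two-paths-even p₂≢p₃ k-even =
    walkEdges Λ₁ , walkEdges Λ₂ , proj₁ (even-paths k-even) , proj₂ (even-paths k-even) ,
    (λ _ → Λ-disjoint p₂≢p₃) , A-walks

lemma4 : (n : ℕ) → 2 ∣ n →
  (ℓ : Fin n → Fin n → ℚ) → (∀ u v → 0ℚ Rat.≤ ℓ u v) → (∀ u v → ℓ u v ≡ ℓ v u) →
  (S : EdgeSet n) → IsTwoFactor S →
  (C : EdgeSet n) → C CycleOf S →
  (p₁ p₂ p₃ p₄ : Fin n) → C p₁ p₂ → C p₃ p₄ →
  p₁ ≢ p₃ → p₁ ≢ p₄ → p₄ ≢ p₂ →
  IsPath p₁ p₂ (C ∖E (p₁ , p₂)) → IsPath p₃ p₄ (C ∖E (p₃ , p₄)) →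
  (k : ℕ) → 1 ≤ k →
  (Q : ℕ → EdgeSet n) (x y : ℕ → Fin n) →
  (∀ i → 1 ≤ i → i ≤ k → IsPath (x i) (y i) (Q i)) →
  (∀ i j → 1 ≤ i → i ≤ k → 1 ≤ j → j ≤ k → i ≢ j → VDisjoint (Q i) (Q j)) →
  (∀ i → 1 ≤ i → i ≤ k →
    ∃[ D ] (D CycleOf S × ¬ (D ≐ C) × ∃[ a ] ∃[ b ] (D a b × Q i ≐ (D ∖E (a , b))))) →
  (S₁ S₂ : EdgeSet n) → IsPathCover S₁ → IsPathCover S₂ →
  (∀ P → (P ∈𝒫 S₁) ⇔ (P ≐ (C ∖E (p₁ , p₂)) ⊎ ∃[ i ] (1 ≤ i × i ≤ k × P ≐ Q i))) →
  (∀ P → (P ∈𝒫 S₂) ⇔ (P ≐ (C ∖E (p₃ , p₄)) ⊎ ∃[ i ] (1 ≤ i × i ≤ k × P ≐ Q i))) →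
  (ℓ p₂ (x 1) Rat.+ ℓ p₃ (y 1)) Rat.≤ (ℓ p₂ (y 1) Rat.+ ℓ p₃ (x 1)) →
  let A1 = A₁ p₁ p₂ k x y
      A2 = A₂ p₃ p₄ k x y
  in (IsTour (S₁ ∪E A1) × IsTour (S₂ ∪E A2))
     × ((∀ v → (v ∈V A1) ⇔ (v ∈V₁ S₁)) × (∀ v → (v ∈V A2) ⇔ (v ∈V₁ S₂)))
     × (EmptyE (A1 ∩E A2)
        × (p₂ ≡ p₃ → IsPath p₁ p₄ (A1 ∪E A2))
        × (p₂ ≢ p₃ → ¬ (2 ∣ k) →
            ∃[ P ] ∃[ P′ ] (IsPath p₁ p₃ P × IsPath p₂ p₄ P′ × VDisjoint P P′ × (A1 ∪E A2) ≐ (P ∪E P′)))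
        × (p₂ ≢ p₃ → 2 ∣ k →
            ∃[ P ] ∃[ P′ ] (IsPath p₁ p₂ P × IsPath p₃ p₄ P′ × VDisjoint P P′ × (A1 ∪E A2) ≐ (P ∪E P′))))
lemma4 n _ ℓ _ _ S two C C-cycle p₁ p₂ p₃ p₄ C₁₂ C₃₄ p₁≢p₃ p₁≢p₄ p₄≢p₂ P₁₂ P₃₄ (suc k′) _ Q x y
       Q-path Q-disjoint Q-cycle S₁ S₂ cover₁ cover₂ components₁ components₂ _ =
  (proj₁ completion₁ , proj₁ completion₂) , (proj₂ completion₁ , proj₂ completion₂) ,
  (A₁∩A₂-empty , A-path , A-two-paths-odd , A-two-paths-even)
  where
  C∩Q : ∀ {i v} → 1 ≤ i → i ≤ suc k′ → v ∈V C → ¬ v ∈V Q i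
  C∩Q 1≤i i≤k = cycle-remainder-disjoint two C-cycle (Q-cycle _ 1≤i i≤k)

  remainder-disjoint : ∀ {a b} i → 1 ≤ i → i ≤ suc k′ → VDisjoint (C ∖E (a , b)) (Q i)
  remainder-disjoint _ 1≤i i≤k _ (w , c , _) = C∩Q 1≤i i≤k (w , c)

  completion₁ = A₁-completes-cover k′ cover₁ P₁₂ Q-path remainder-disjoint Q-disjoint components₁
  -- A₂ p₃ p₄ k x y is by definition A₁ p₄ p₃ k y x, the joining edges of the reversed paths.
  completion₂ = A₁-completes-cover k′ cover₂ (IsPath-reverse P₃₄)
                  (λ i 1≤i i≤k → IsPath-reverse (Q-path i 1≤i i≤k)) remainder-disjoint Q-disjoint components₂

  open Zigzag p₁ p₂ p₃ p₄ k′ x y (_∈V C)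
    (p₂ , C₁₂) (p₁ , IsCycle-sym (proj₁ C-cycle) C₁₂) (p₄ , C₃₄) (p₃ , IsCycle-sym (proj₁ C-cycle) C₃₄)
    (λ 1≤i i≤k v∈C end → C∩Q 1≤i i≤k v∈C (IsPath-end∈V (Q-path _ 1≤i i≤k) end))
    (disjoint-paths-end-index Q-path Q-disjoint)
    (λ 1≤i i≤k → IsPath⇒≢ (Q-path _ 1≤i i≤k))
    (IsPath⇒≢ P₁₂) (IsPath⇒≢ P₃₄) p₁≢p₃ p₁≢p₄ p₄≢p₂
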